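{- Under the RAM model of computation, the $\oplus$-indecomposable canonical decomposition tree corresponding to a given packed tree with $n$ leaves can be computed in $O(n)$ steps.
   Context: Let $\oplus_k=12\cdots k$, $\ominus_k=k\cdots 1$ ($k\ge2$), and call a permutation of size $\ge3$ simple if it cannot be written as a non-trivial substitution $\sigma[\nu_1,\dots,\nu_m]$ (substitution replaces the point $(i,\sigma(i))$ of the diagram of $\sigma$ by the diagram of $\nu_i$). Fix a substitution-closed class $\mathcal{C}$ of permutations with set $\mathcal{S}$ of simple permutations in $\mathcal{C}$. A canonical decomposition tree is a rooted plane tree whose internal vertices are decorated by permutations from $\mathcal{S}\cup\{\oplus_k,\ominus_k:k\ge2\}$ of size equal to their number of children, with no two adjacent internal vertices both $\oplus$-decorated or both $\ominus$-decorated; it is $\oplus$-indecomposable if its root is not decorated by some $\oplus_k$. A gadget is a canonical decomposition tree of height at most $2$ whose root is internal and decorated by a simple permutation from $\mathcal{S}$, each child of the root being either a leaf or an internal vertex decorated by some $\oplus_k$; its size is its number of leaves. $\mathcal{Q}$ is the class consisting of all gadgets together with formal objects $\circledast_k$ of size $k$, $k\ge2$. A packed tree is a rooted plane tree whose internal vertices are decorated by objects of $\mathcal{Q}$ of size equal to their number of children; its size is its number of leaves. The corresponding $\oplus$-indecomposable canonical decomposition tree is obtained by (i) replacing every internal vertex $v$ decorated by a gadget $G$ with $d$ children by $G$ itself: delete $v$, attach the root of $G$ to the parent of $v$, and for $1\le i\le d$ identify the $i$-th leaf of $G$ with the root of the $i$-th subtree of $v$; then (ii) traversing the resulting tree in breadth-first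 order and replacing each decoration $\circledast_k$ by $\ominus_k$ if the vertex is the root, and otherwise by the sign ($\oplus_k$ or $\ominus_k$) opposite to that of its parent's decoration. RAM model: unit-cost arithmetic, logic and memory access. -}

module Defs where

open import Data.Nat using (ℕ; zero; suc; _+_; _*_; _∸_; _≤_; _<_; _<?_; _≟_)
open import Data.Nat.Base using (_⊔_)
open import Data.List using (List; []; _∷_; length; map; concat; zip; zipWith; filter; sum; upTo; _++_)
open import Data.List.Relation.Unary.All using (All)
open import Data.List.Relation.Unary.Any using (Any)
open import Data.List.Relation.Binary.Permutation.Propositional using (_↭_)
open import Data.List.Relation.Binary.Sublist.Propositional using (_⊆_)
open import Data.Maybe using (Maybe; just; nothing)
open import Data.Product using (Σ; _×_; _,_; proj₁; proj₂)
open import Relation.Binary.PropositionalEquality using (_≡_)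
open import Data.Empty using (⊥)
open import Data.Unit using (⊤)
open import Relation.Nullary using (¬_; yes; no)

-- Permutations (one-line notation, values 1..k)

Perm : Set
Perm = List ℕ

IsPerm : Perm → Set
IsPerm π = π ↭ map suc (upTo (length π))

-- substitution σ[ν₁,…,νₘ]: the block of νᵢ is shifted by the total size
-- of the νⱼ with σ(j) < σ(i)
offset : List (ℕ × ℕ) → ℕ → ℕ
offset [] v = 0
offset ((w , len) ∷ ps) v with w <? v
... | yes _ = len + offset ps v
... | no  _ = offset ps v

subst : Perm → List Perm → Perm
subst σ νs =
  concat (zipWith (λ v ν → map (_+ offset (zip σ (map length νs)) v) ν) σ νs)

NonTrivialSubst : Perm → List Perm → Set
NonTrivialSubst σ νs = (2 ≤ length σ) × Any (λ ν → 2 ≤ length ν) νs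

IsSubstitution : Perm → List Perm → Set
IsSubstitution σ νs =
  IsPerm σ × (length νs ≡ length σ) × All IsPerm νs × All (λ ν → 1 ≤ length ν) νs

Simple : Perm → Set
Simple π = (3 ≤ length π) × IsPerm π ×
  ¬ (Σ Perm λ σ → Σ (List Perm) λ νs →
       IsSubstitution σ νs × NonTrivialSubst σ νs × (π ≡ subst σ νs))

std : List ℕ → List ℕ
std s = map (λ x → suc (length (filter (_<? x) s))) s

Contains : Perm → Perm → Set
Contains π τ = Σ (List ℕ) λ s → (s ⊆ π) × (std s ≡ τ)

IsPermClass : (Perm → Set) → Set
IsPermClass C = (∀ π → C π → IsPerm π) ×
                (∀ π τ → C π → IsPerm τ → Contains π τ → C τ)

SubstClosed : (Perm → Set) → Set
SubstClosed C = ∀ σ νs → IsSubstitution σ νs → C σ → All C νs → C (subst σ νs)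

SimplesOf : (Perm → Set) → Perm → Set
SimplesOf C π = C π × Simple π

data Tree (D : Set) : Set where
  leaf : Tree D
  node : D → List (Tree D) → Tree D

mutual
  leaves : ∀ {D} → Tree D → ℕ
  leaves leaf = 1
  leaves (node _ ts) = leavesL ts

  leavesL : ∀ {D} → List (Tree D) → ℕ
  leavesL [] = 0
  leavesL (t ∷ ts) = leaves t + leavesL ts

mutual
  height : ∀ {D} → Tree D → ℕ
  height leaf = 0
  height (node _ ts) = suc (heightL ts)

  heightL : ∀ {D} → List (Tree D) → ℕ
  heightL [] = 0
  heightL (t ∷ ts) = height t ⊔ heightL ts

data CDec : Set where
  simp  : Perm → CDec
  plus  : ℕ → CDec
  minus : ℕ → CDec

cSize : CDec → ℕ
cSize (simp π) = length π
cSize (plus k) = k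
cSize (minus k) = k

ValidC : (Perm → Set) → CDec → Set
ValidC S (simp π) = S π
ValidC S (plus k) = 2 ≤ k
ValidC S (minus k) = 2 ≤ k

SignOK : CDec → Tree CDec → Set
SignOK (plus _)  (node (plus _) _)   = ⊥
SignOK (minus _) (node (minus _) _)  = ⊥
SignOK _ _ = ⊤

data Canonical (S : Perm → Set) : Tree CDec → Set where
  leafC : Canonical S leaf
  nodeC : ∀ d ts → ValidC S d → cSize d ≡ length ts →
          All (SignOK d) ts → All (Canonical S) ts → Canonical S (node d ts)

IsPlusNode : Tree CDec → Set
IsPlusNode (node (plus _) _) = ⊤
IsPlusNode _ = ⊥

LeafOrPlus : Tree CDec → Set
LeafOrPlus leaf = ⊤
LeafOrPlus t = IsPlusNode t

IsGadget : (Perm → Set) → Tree CDec → Set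
IsGadget S leaf = ⊥
IsGadget S (node (plus _) _) = ⊥
IsGadget S (node (minus _) _) = ⊥
IsGadget S G@(node (simp π) ts) =
  Canonical S G × (height G ≤ 2) × S π × All LeafOrPlus ts

data QDec : Set where
  gad  : Tree CDec → QDec
  circ : ℕ → QDec

qSize : QDec → ℕ
qSize (gad G) = leaves G
qSize (circ k) = k

ValidQ : (Perm → Set) → QDec → Set
ValidQ S (gad G) = IsGadget S G
ValidQ S (circ k) = 2 ≤ k

data Packed (S : Perm → Set) : Tree QDec → Set where
  leafP : Packed S leaf
  nodeP : ∀ q ts → ValidQ S q → qSize q ≡ length ts →
          All (Packed S) ts → Packed S (node q ts)

data IDec : Set where
  cd    : CDec → IDec
  circI : ℕ → IDec

-- (i) graft: replace the i-th leaf of the gadget by the i-th subtree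
mutual
  graft : Tree CDec → List (Tree IDec) → Tree IDec × List (Tree IDec)
  graft leaf [] = leaf , []
  graft leaf (t ∷ rest) = t , rest
  graft (node d gs) rest with graftL gs rest
  ... | (gs' , rest') = node (cd d) gs' , rest'

  graftL : List (Tree CDec) → List (Tree IDec) → List (Tree IDec) × List (Tree IDec)
  graftL [] rest = [] , rest
  graftL (g ∷ gs) rest with graft g rest
  ... | (g' , rest') with graftL gs rest'
  ...   | (gs' , rest'') = (g' ∷ gs') , rest''

mutual
  expand : Tree QDec → Tree IDec
  expand leaf = leaf
  expand (node (gad G) ts) = proj₁ (graft G (expandL ts))
  expand (node (circ k) ts) = node (circI k) (expandL ts)

  expandL : List (Tree QDec) → List (Tree IDec)
  expandL [] = []
  expandL (t ∷ ts) = expand t ∷ expandL ts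

-- (ii) resolve ⊛_k top-down (equivalently in breadth-first order)
opposite : CDec → ℕ → CDec
opposite (minus _) k = plus k
opposite _ k = minus k

resolveDec : Maybe CDec → IDec → CDec
resolveDec _ (cd d) = d
resolveDec nothing (circI k) = minus k
resolveDec (just p) (circI k) = opposite p k

mutual
  resolve : Maybe CDec → Tree IDec → Tree CDec
  resolve _ leaf = leaf
  resolve p (node e ts) = node (resolveDec p e) (resolveL (just (resolveDec p e)) ts)

  resolveL : Maybe CDec → List (Tree IDec) → List (Tree CDec)
  resolveL _ [] = []
  resolveL p (t ∷ ts) = resolve p t ∷ resolveL p ts

toCanonical : Tree QDec → Tree CDec
toCanonical t = resolve nothing (expand t)

mutual
  encTree : ∀ {D} → (D → List ℕ) → Tree D → List ℕ
  encTree e leaf = 0 ∷ []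
  encTree e (node d ts) = 1 ∷ e d ++ (length ts ∷ encTreeL e ts)

  encTreeL : ∀ {D} → (D → List ℕ) → List (Tree D) → List ℕ
  encTreeL e [] = []
  encTreeL e (t ∷ ts) = encTree e t ++ encTreeL e ts

encCDec : CDec → List ℕ
encCDec (simp π) = 0 ∷ length π ∷ π
encCDec (plus k) = 1 ∷ k ∷ []
encCDec (minus k) = 2 ∷ k ∷ []

encQDec : QDec → List ℕ
encQDec (gad G) = 0 ∷ encTree encCDec G
encQDec (circ k) = 1 ∷ k ∷ []

-- RAM model: memory ℕ → ℕ, unit cost per instruction

Mem : Set
Mem = ℕ → ℕ

data Instr : Set where
  CONST : ℕ → ℕ → Instr
  ADD   : ℕ → ℕ → ℕ → Instr
  SUB   : ℕ → ℕ → ℕ → Instr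
  LOAD  : ℕ → ℕ → Instr
  STORE : ℕ → ℕ → Instr
  JZ    : ℕ → ℕ → Instr
  HALT  : Instr

Program : Set
Program = List Instr

fetch : Program → ℕ → Maybe Instr
fetch [] _ = nothing
fetch (i ∷ is) zero = just i
fetch (i ∷ is) (suc n) = fetch is n

write : Mem → ℕ → ℕ → Mem
write m a v x with x ≟ a
... | yes _ = v
... | no  _ = m x

-- run for at most `fuel` steps; `just m` iff HALT is reached (HALT counts as a step)
exec : Program → ℕ → ℕ → Mem → Maybe Mem
exec P zero pc m = nothing
exec P (suc f) pc m with fetch P pc
... | nothing = nothing
... | just HALT = just m
... | just (CONST r c) = exec P f (suc pc) (write m r c)
... | just (ADD r a b) = exec P f (suc pc) (write m r (m a + m b))
... | just (SUB r a b) = exec P f (suc pc) (write m r (m a ∸ m b))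
... | just (LOAD r a) = exec P f (suc pc) (write m r (m (m a)))
... | just (STORE a r) = exec P f (suc pc) (write m (m a) (m r))
... | just (JZ r l) with m r
...   | zero = exec P f l m
...   | suc _ = exec P f (suc pc) m

-- input/output convention: M[0] = length, M[1..len] = the words
lookupD : List ℕ → ℕ → ℕ
lookupD [] _ = 0
lookupD (x ∷ xs) zero = x
lookupD (x ∷ xs) (suc i) = lookupD xs i

initMem : List ℕ → Mem
initMem xs zero = length xs
initMem xs (suc i) = lookupD xs i

readOut : Mem → List ℕ
readOut m = map (λ i → m (suc i)) (upTo (m 0))

{-# OPTIONS --safe #-}
-- The RAM program `transducer` translates in one left-to-right pass over the preorder
-- encoding of the packed tree, with an explicit stack.  A ⊛ vertex is emitted at once: its
-- sign only depends on whether the parent is ⊖, which the program keeps in a flag.  For a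
-- gadget vertex the program first skips over the encoding of the gadget to reach the
-- encodings of the subtrees, and then walks gadget and subtrees in parallel, copying the
-- vertices of the gadget and translating the i-th subtree at the i-th leaf of the gadget.
-- Output and stack grow in the interleaved even and odd cells of one memory region; a last
-- loop moves the output to the cells 1, 2, ….  Every input word is read a bounded number of
-- times, so the running time is linear in the length of the input encoding, and that
-- length is at most 13 times the number of leaves, because every vertex has at least two
-- children and every gadget at least three leaves.

module Submission where

open import Defs hiding (subst)
open import Data.Empty using (⊥; ⊥-elim)
open import Data.List using (List; []; _∷_; length; _++_; _ʳ++_)
open import Data.List.Properties using (length-++; length-++-≤ˡ; ++-ʳ++; length-ʳ++)
open import Data.List.Relation.Unary.All using (All; []; _∷_)
import Data.List.Relation.Unary.All.Properties as AllP
open import Data.Maybe using (Maybe; just; nothing; map)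
open import Data.Nat
open import Data.Nat.Properties
open import Data.Nat.Tactic.RingSolver
open import Data.Product using (Σ; _×_; _,_; proj₁; proj₂)
open import Data.Sum using (inj₁; inj₂)
open import Data.Unit using (⊤; tt)
open import Data.Vec using (Vec; []; _∷_)
open import Relation.Binary.PropositionalEquality
open import Relation.Nullary using (yes; no; ¬_)

module RAM where

  Heap : Set
  Heap = ℕ → ℕ

  execJZ : Program → ℕ → ℕ → ℕ → Mem → ℕ → Maybe Mem
  execJZ P f pc l m zero = exec P f l m
  execJZ P f pc l m (suc _) = exec P f (suc pc) m

  execFetched : Program → ℕ → ℕ → Mem → Maybe Instr → Maybe Mem
  execFetched P f pc m nothing = nothing
  execFetched P f pc m (just HALT) = just m
  execFetched P f pc m (just (CONST r c)) = exec P f (suc pc) (write m r c)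
  execFetched P f pc m (just (ADD r a b)) = exec P f (suc pc) (write m r (m a + m b))
  execFetched P f pc m (just (SUB r a b)) = exec P f (suc pc) (write m r (m a ∸ m b))
  execFetched P f pc m (just (LOAD r a)) = exec P f (suc pc) (write m r (m (m a)))
  execFetched P f pc m (just (STORE a r)) = exec P f (suc pc) (write m (m a) (m r))
  execFetched P f pc m (just (JZ r l)) = execJZ P f pc l m (m r)

  exec-suc : ∀ P f pc m → exec P (suc f) pc m ≡ execFetched P f pc m (fetch P pc)
  exec-suc P f pc m with fetch P pc
  ... | nothing = refl
  ... | just HALT = refl
  ... | just (CONST r c) = refl
  ... | just (ADD r a b) = refl
  ... | just (SUB r a b) = refl
  ... | just (LOAD r a) = refl
  ... | just (STORE a r) = refl
  ... | just (JZ r l) with m r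
  ...   | zero = refl
  ...   | suc _ = refl

  data _≋_ : Maybe Mem → Maybe Mem → Set where
    ≋-nothing : nothing ≋ nothing
    ≋-just : ∀ {m m'} → m ≗ m' → just m ≋ just m'

  ≋-refl : ∀ {a} → a ≋ a
  ≋-refl {nothing} = ≋-nothing
  ≋-refl {just m} = ≋-just (λ x → refl)

  ≋-trans : ∀ {a b c} → a ≋ b → b ≋ c → a ≋ c
  ≋-trans ≋-nothing ≋-nothing = ≋-nothing
  ≋-trans (≋-just p) (≋-just q) = ≋-just (λ x → trans (p x) (q x))

  write-hit : ∀ m a v → write m a v a ≡ v
  write-hit m a v with a ≟ a
  ... | yes _ = refl
  ... | no ¬p = ⊥-elim (¬p refl)

  write-miss : ∀ m a v x → ¬ x ≡ a → write m a v x ≡ m x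
  write-miss m a v x ne with x ≟ a
  ... | yes p = ⊥-elim (ne p)
  ... | no _ = refl

  write-cong : ∀ {m m'} a v → m ≗ m' → write m a v ≗ write m' a v
  write-cong {m} {m'} a v eq x with x ≟ a
  ... | yes _ = refl
  ... | no _ = eq x

  exec-cong : ∀ P f pc {m m'} → m ≗ m' → exec P f pc m ≋ exec P f pc m'
  exec-cong P zero pc eq = ≋-nothing
  exec-cong P (suc f) pc {m} {m'} eq
    rewrite exec-suc P f pc m | exec-suc P f pc m' = byInstr (fetch P pc)
    where
    byInstr : ∀ mi → execFetched P f pc m mi ≋ execFetched P f pc m' mi
    byInstr nothing = ≋-nothing
    byInstr (just HALT) = ≋-just eq
    byInstr (just (CONST r c)) = exec-cong P f (suc pc) (write-cong r c eq)
    byInstr (just (ADD r a b)) rewrite eq a | eq b = exec-cong P f (suc pc) (write-cong r _ eq)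
    byInstr (just (SUB r a b)) rewrite eq a | eq b = exec-cong P f (suc pc) (write-cong r _ eq)
    byInstr (just (LOAD r a)) rewrite eq a | eq (m' a) = exec-cong P f (suc pc) (write-cong r _ eq)
    byInstr (just (STORE a r)) rewrite eq a | eq r = exec-cong P f (suc pc) (write-cong (m' a) _ eq)
    byInstr (just (JZ r l)) rewrite eq r = gj (m' r)
      where
      gj : ∀ v → execJZ P f pc l m v ≋ execJZ P f pc l m' v
      gj zero = exec-cong P f l eq
      gj (suc _) = exec-cong P f (suc pc) eq

  Reaches : Program → ℕ → ℕ → Mem → ℕ → Mem → Set
  Reaches P k pc m pc' m' = ∀ f → exec P (k + f) pc m ≋ exec P f pc' m'

  infixr 4 _⟫_
  _⟫_ : ∀ {P a b pc1 m1 pc2 m2 pc3 m3} → Reaches P a pc1 m1 pc2 m2 → Reaches P b pc2 m2 pc3 m3 →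
        Reaches P (a + b) pc1 m1 pc3 m3
  _⟫_ {P} {a} {b} {pc1} {m1} {pc2} {m2} {pc3} {m3} r1 r2 f =
    subst (λ z → exec P z pc1 m1 ≋ exec P f pc3 m3) (sym (+-assoc a b f)) (≋-trans (r1 (b + f)) (r2 f))

  reaches-≗ : ∀ {P pc m m'} → m ≗ m' → Reaches P 0 pc m pc m'
  reaches-≗ {P} {pc} eq f = exec-cong P f pc eq

  exec-HALT : ∀ P pc m f → fetch P pc ≡ just HALT → exec P (suc f) pc m ≡ just m
  exec-HALT P pc m f eq rewrite exec-suc P f pc m | eq = refl

  withRegs : ∀ {k} → Vec ℕ k → Heap → Mem
  withRegs [] h x = h x
  withRegs (v ∷ vs) h zero = v
  withRegs (v ∷ vs) h (suc x) = withRegs vs h x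

  -- Opaque, so that running the program by normalisation leaves writes to unknown heap
  -- addresses symbolic instead of unfolding `_≟_` on them.
  opaque
    heapWrite : Heap → ℕ → ℕ → Heap
    heapWrite = write

  opaque
    unfolding heapWrite
    heapWrite-hit : ∀ h a v → heapWrite h a v a ≡ v
    heapWrite-hit = write-hit

    heapWrite-miss : ∀ h a v x → ¬ x ≡ a → heapWrite h a v x ≡ h x
    heapWrite-miss = write-miss

    write≗heapWrite : ∀ h a v → write h a v ≗ heapWrite h a v
    write≗heapWrite h a v x = refl

  setReg : ∀ {k} → Vec ℕ k → ℕ → ℕ → Vec ℕ k
  setReg [] r v = []
  setReg (x ∷ xs) zero v = v ∷ xs
  setReg (x ∷ xs) (suc r) v = x ∷ setReg xs r v

  heapAddr : ∀ {k} → Vec ℕ k → ℕ → Maybe ℕ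
  heapAddr [] x = just x
  heapAddr (v ∷ vs) zero = nothing
  heapAddr (v ∷ vs) (suc x) = heapAddr vs x

  heapWriteAt : Heap → Maybe ℕ → ℕ → Heap
  heapWriteAt h nothing w = h
  heapWriteAt h (just y) w = heapWrite h y w

  writeState : ∀ {k} → Vec ℕ k → Heap → ℕ → ℕ → Vec ℕ k × Heap
  writeState rs h x w = setReg rs x w , heapWriteAt h (heapAddr rs x) w

  write-suc : ∀ m x w y → write m (suc x) w (suc y) ≡ write (λ z → m (suc z)) x w y
  write-suc m x w y with y ≟ x
  ... | yes refl = write-hit m (suc y) w
  ... | no ne = write-miss m (suc x) w (suc y) (λ e → ne (suc-injective e))

  write-withRegs : ∀ {k} (vs : Vec ℕ k) h x w → write (withRegs vs h) x w ≗ withRegs (proj₁ (writeState vs h x w)) (proj₂ (writeState vs h x w))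
  write-withRegs [] h x w y = write≗heapWrite h x w y
  write-withRegs (v ∷ vs) h zero w zero = refl
  write-withRegs (v ∷ vs) h zero w (suc y) = refl
  write-withRegs (v ∷ vs) h (suc x) w zero = refl
  write-withRegs (v ∷ vs) h (suc x) w (suc y) = trans (write-suc (withRegs (v ∷ vs) h) x w y) (write-withRegs vs h x w y)

  setReg-≗ : ∀ {k} (rs : Vec ℕ k) h r v → withRegs rs h r ≡ v → withRegs rs h ≗ withRegs (setReg rs r v) h
  setReg-≗ [] h r v eq y = refl
  setReg-≗ (x ∷ rs) h zero v eq zero = eq
  setReg-≗ (x ∷ rs) h zero v eq (suc y) = refl
  setReg-≗ (x ∷ rs) h (suc r) v eq zero = refl
  setReg-≗ (x ∷ rs) h (suc r) v eq (suc y) = setReg-≗ rs h r v eq y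

  State : ℕ → Set
  State k = ℕ × Vec ℕ k × Heap

  pcOf : ∀ {k} → State k → ℕ
  pcOf s = proj₁ s

  memOf : ∀ {k} → State k → Mem
  memOf s = withRegs (proj₁ (proj₂ s)) (proj₂ (proj₂ s))

  jzTarget : ℕ → ℕ → ℕ → ℕ
  jzTarget zero l pc = l
  jzTarget (suc _) l pc = suc pc

  stepInstr : ∀ {k} → Instr → ℕ → Vec ℕ k → Heap → Maybe (State k)
  stepInstr HALT pc rs h = nothing
  stepInstr (CONST r c) pc rs h = just (suc pc , writeState rs h r c)
  stepInstr (ADD r a b) pc rs h = just (suc pc , writeState rs h r (withRegs rs h a + withRegs rs h b))
  stepInstr (SUB r a b) pc rs h = just (suc pc , writeState rs h r (withRegs rs h a ∸ withRegs rs h b))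
  stepInstr (LOAD r a) pc rs h = just (suc pc , writeState rs h r (withRegs rs h (withRegs rs h a)))
  stepInstr (STORE a r) pc rs h = just (suc pc , writeState rs h (withRegs rs h a) (withRegs rs h r))
  stepInstr (JZ r l) pc rs h = just (jzTarget (withRegs rs h r) l pc , rs , h)

  step : ∀ {k} → Maybe Instr → ℕ → Vec ℕ k → Heap → Maybe (State k)
  step nothing pc rs h = nothing
  step (just i) pc rs h = stepInstr i pc rs h

  mutual
    run : ∀ {k} → Program → ℕ → State k → Maybe (State k)
    run P zero s = just s
    run P (suc n) (pc , rs , h) = runFrom P n (step (fetch P pc) pc rs h)

    runFrom : ∀ {k} → Program → ℕ → Maybe (State k) → Maybe (State k)
    runFrom P n nothing = nothing
    runFrom P n (just s) = run P n s

  StateReaches : ∀ {k j} → Program → ℕ → State k → State j → Set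
  StateReaches P n s s' = Reaches P n (pcOf s) (memOf s) (pcOf s') (memOf s')

  step-sound : ∀ {k} P f pc (rs : Vec ℕ k) h mi s1 → step mi pc rs h ≡ just s1 →
            execFetched P f pc (withRegs rs h) mi ≋ exec P f (pcOf s1) (memOf s1)
  step-sound P f pc rs h nothing s1 ()
  step-sound P f pc rs h (just HALT) s1 ()
  step-sound P f pc rs h (just (CONST r c)) s1 refl = exec-cong P f (suc pc) (write-withRegs rs h r c)
  step-sound P f pc rs h (just (ADD r a b)) s1 refl = exec-cong P f (suc pc) (write-withRegs rs h r _)
  step-sound P f pc rs h (just (SUB r a b)) s1 refl = exec-cong P f (suc pc) (write-withRegs rs h r _)
  step-sound P f pc rs h (just (LOAD r a)) s1 refl = exec-cong P f (suc pc) (write-withRegs rs h r _)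
  step-sound P f pc rs h (just (STORE a r)) s1 refl = exec-cong P f (suc pc) (write-withRegs rs h _ _)
  step-sound P f pc rs h (just (JZ r l)) s1 refl = gj (withRegs rs h r)
    where
    gj : ∀ v → execJZ P f pc l (withRegs rs h) v ≋ exec P f (jzTarget v l pc) (withRegs rs h)
    gj zero = ≋-refl
    gj (suc _) = ≋-refl

  run-sound : ∀ {k} P n (s s' : State k) → run P n s ≡ just s' → StateReaches P n s s'
  run-sound P zero s s' refl f = ≋-refl
  run-sound P (suc n) (pc , rs , h) s' eq f
    rewrite exec-suc P (n + f) pc (withRegs rs h) = byStep (fetch P pc) eq
    where
    byStep : ∀ mi → runFrom P n (step mi pc rs h) ≡ just s' →
         execFetched P (n + f) pc (withRegs rs h) mi ≋ exec P f (pcOf s') (memOf s')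
    byStep mi eq2 with step mi pc rs h in e
    ... | just s1 = ≋-trans (step-sound P (n + f) pc rs h mi s1 e) (run-sound P n s1 s' eq2 f)

  -- Unlike `StateReaches`, a record keeps both states as indices, so that the intermediate
  -- states of a chain `r₁ ⟩ r₂ ⟩ …` can be inferred.
  record Steps {k j : ℕ} (P : Program) (n : ℕ) (s : State k) (s' : State j) : Set where
    constructor mkSteps
    field reaches : StateReaches P n s s'
  open Steps public

  infixr 4 _⟩_
  _⟩_ : ∀ {k j i P a b} {s1 : State k} {s2 : State j} {s3 : State i} → Steps P a s1 s2 → Steps P b s2 s3 → Steps P (a + b) s1 s3
  _⟩_ {P = P} {a} {b} {s1} {s2} {s3} (mkSteps r1) (mkSteps r2) = mkSteps (_⟫_ {P} {a} {b} {pcOf s1} {memOf s1} {pcOf s2} {memOf s2} {pcOf s3} {memOf s3} r1 r2)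

  -- Symbolic execution: `compute` runs the program by normalisation as long as the control
  -- flow is determined, and `rewriteReg` replaces a register holding an unknown heap read by
  -- its value, known from an invariant, so that the next jump can be decided.
  rewriteReg : ∀ {k P pc h} {regs : Vec ℕ k} r v → withRegs regs h r ≡ v → Steps P 0 (pc , regs , h) (pc , setReg regs r v , h)
  rewriteReg {h = h} {regs = regs} r v eq = mkSteps (reaches-≗ (setReg-≗ regs h r v eq))

  Steps-cost : ∀ {k j P a b} {s : State k} {s' : State j} → a ≡ b → Steps P a s s' → Steps P b s s'
  Steps-cost refl r = r

  Steps-halt : ∀ {k j P n} {s : State k} {s' : State j} → Steps P n s s' → fetch P (pcOf s') ≡ just HALT →
            exec P (n + 1) (pcOf s) (memOf s) ≋ just (memOf s')
  Steps-halt {P = P} {s' = s'} (mkSteps r) eq = subst (λ z → _ ≋ z) (exec-HALT P (pcOf s') (memOf s') 0 eq) (r 1)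

  compute : ∀ {k} {P} n (s s' : State k) → run P n s ≡ just s' → Steps P n s s'
  compute {P = P} n s s' eq = mkSteps (run-sound P n s s' eq)

  reframe : ∀ {k j} {P} (s : State k) (s' : State j) → pcOf s ≡ pcOf s' → memOf s ≗ memOf s' → Steps P 0 s s'
  reframe (pc , rs , h) (pc' , rs' , h') refl eq = mkSteps (reaches-≗ eq)

  map-applyUpTo : ∀ (O : List ℕ) (f g : ℕ → ℕ) → (∀ i → i < length O → f (g i) ≡ lookupD O i) →
              Data.List.map f (Data.List.applyUpTo g (length O)) ≡ O
  map-applyUpTo [] f g hyp = refl
  map-applyUpTo (o ∷ O) f g hyp = cong₂ _∷_ (hyp 0 (s≤s z≤n)) (map-applyUpTo O f (λ i → g (suc i)) (λ i lt → hyp (suc i) (s≤s lt)))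

  readOut-≡ : ∀ (m : Mem) O → m 0 ≡ length O → (∀ i → i < length O → m (suc i) ≡ lookupD O i) → readOut m ≡ O
  readOut-≡ m O e hyp rewrite e = map-applyUpTo O (λ i → m (suc i)) (λ i → i) hyp

  readOut-result : ∀ {r : Maybe Mem} {mf : Mem} O → r ≋ just mf → mf 0 ≡ length O →
          (∀ i → i < length O → mf (suc i) ≡ lookupD O i) → map readOut r ≡ just O
  readOut-result {mf = mf} O (≋-just {m} eq) e0 hyp = cong just (readOut-≡ m O (trans (eq 0) e0) (λ i lt → trans (eq (suc i)) (hyp i lt)))


module Output where

  encQ : Tree QDec → List ℕ
  encQ = encTree encQDec
  encQL : List (Tree QDec) → List ℕ
  encQL = encTreeL encQDec
  encC : Tree CDec → List ℕ
  encC = encTree encCDec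
  encCL : List (Tree CDec) → List ℕ
  encCL = encTreeL encCDec

  qLen : Tree QDec → ℕ
  qLen t = length (encQ t)
  qLenL : List (Tree QDec) → ℕ
  qLenL ts = length (encQL ts)
  cLen : Tree CDec → ℕ
  cLen g = length (encC g)
  cLenL : List (Tree CDec) → ℕ
  cLenL gs = length (encCL gs)

  out : Maybe CDec → Tree QDec → List ℕ
  out pp t = encC (resolve pp (expand t))

  outNode : CDec → List (Tree CDec) → List (Tree QDec) → List ℕ
  outNode d gs ts = encC (node d (resolveL (just d) (proj₁ (graftL gs (expandL ts)))))

  outChildren : CDec → List (Tree CDec) → List (Tree QDec) → List ℕ
  outChildren d gs ts = encCL (resolveL (just d) (proj₁ (graftL gs (expandL ts))))

  -- `opposite` turns every parent decoration other than ⊖ into ⊖, so one bit of the parent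
  -- decoration suffices to resolve a ⊛.
  minusFlag : Maybe CDec → ℕ
  minusFlag nothing = 0
  minusFlag (just (simp _)) = 0
  minusFlag (just (plus _)) = 0
  minusFlag (just (minus _)) = 1

  encCDec-resolveCirc : ∀ pp k → encCDec (resolveDec pp (circI k)) ≡ (2 ∸ minusFlag pp) ∷ k ∷ []
  encCDec-resolveCirc nothing k = refl
  encCDec-resolveCirc (just (simp x)) k = refl
  encCDec-resolveCirc (just (plus x)) k = refl
  encCDec-resolveCirc (just (minus x)) k = refl

  minusFlag-resolveCirc : ∀ pp k → minusFlag (just (resolveDec pp (circI k))) ≡ 1 ∸ minusFlag pp
  minusFlag-resolveCirc nothing k = refl
  minusFlag-resolveCirc (just (simp x)) k = refl
  minusFlag-resolveCirc (just (plus x)) k = refl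
  minusFlag-resolveCirc (just (minus x)) k = refl

  NotMinus : CDec → Set
  NotMinus (minus _) = ⊥
  NotMinus _ = ⊤

  minusFlag-NotMinus : ∀ d → NotMinus d → minusFlag (just d) ≡ 0
  minusFlag-NotMinus (simp x) _ = refl
  minusFlag-NotMinus (plus x) _ = refl

  mutual
    MinusFree : Tree CDec → Set
    MinusFree leaf = ⊤
    MinusFree (node d gs) = NotMinus d × MinusFreeL gs

    MinusFreeL : List (Tree CDec) → Set
    MinusFreeL [] = ⊤
    MinusFreeL (g ∷ gs) = MinusFree g × MinusFreeL gs

  -- The consequences of being packed that the correctness of the transducer relies on.
  mutual
    Shaped : Tree QDec → Set
    Shaped leaf = ⊤
    Shaped (node (circ k) ts) = ShapedL ts
    Shaped (node (gad leaf) ts) = ⊥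
    Shaped (node (gad (node d gs)) ts) = MinusFree (node d gs) × (leavesL gs ≡ length ts) × ShapedL ts

    ShapedL : List (Tree QDec) → Set
    ShapedL [] = ⊤
    ShapedL (t ∷ ts) = Shaped t × ShapedL ts

  length-expandL : ∀ ts → length (expandL ts) ≡ length ts
  length-expandL [] = refl
  length-expandL (t ∷ ts) = cong suc (length-expandL ts)

  length-resolveL : ∀ p ts → length (resolveL p ts) ≡ length ts
  length-resolveL p [] = refl
  length-resolveL p (t ∷ ts) = cong suc (length-resolveL p ts)

  length-graftL : ∀ gs r → length (proj₁ (graftL gs r)) ≡ length gs
  length-graftL [] r = refl
  length-graftL (g ∷ gs) r = cong suc (length-graftL gs (proj₂ (graft g r)))

  encTreeL-++ : ∀ {D} (e : D → List ℕ) xs ys → encTreeL e (xs ++ ys) ≡ encTreeL e xs ++ encTreeL e ys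
  encTreeL-++ e [] ys = refl
  encTreeL-++ e (x ∷ xs) ys rewrite encTreeL-++ e xs ys = sym (Data.List.Properties.++-assoc (encTree e x) (encTreeL e xs) (encTreeL e ys))

  expandL-++ : ∀ xs ys → expandL (xs ++ ys) ≡ expandL xs ++ expandL ys
  expandL-++ [] ys = refl
  expandL-++ (x ∷ xs) ys = cong (expand x ∷_) (expandL-++ xs ys)

  splitAtLength : ∀ {A : Set} k (L : List A) → k ≤ length L →
           Σ (List A) λ L1 → Σ (List A) λ L2 → (L ≡ L1 ++ L2) × (length L1 ≡ k)
  splitAtLength zero L _ = [] , L , refl , refl
  splitAtLength (suc k) (x ∷ L) (s≤s le) with splitAtLength k L le
  ... | L1 , L2 , e1 , e2 = x ∷ L1 , L2 , cong (x ∷_) e1 , cong suc e2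

  mutual
    graft-++ : ∀ g (L R : List (Tree IDec)) → length L ≡ leaves g → graft g (L ++ R) ≡ (proj₁ (graft g L) , R)
    graft-++ leaf (x ∷ []) R refl = refl
    graft-++ (node d gs) L R e rewrite graftL-++ gs L R e = refl

    graftL-++ : ∀ gs (L R : List (Tree IDec)) → length L ≡ leavesL gs → graftL gs (L ++ R) ≡ (proj₁ (graftL gs L) , R)
    graftL-++ [] [] R refl = refl
    graftL-++ (g ∷ gs) L R e with splitAtLength (leaves g) L (subst (leaves g ≤_) (sym e) (m≤m+n (leaves g) (leavesL gs)))
    ... | L1 , L2 , refl , e2
      rewrite Data.List.Properties.++-assoc L1 L2 R
            | graft-++ g L1 (L2 ++ R) e2
            | graft-++ g L1 L2 e2
            | graftL-++ gs L2 R (+-cancelˡ-≡ (leaves g) _ _ (trans (trans (cong (_+ length L2) (sym e2)) (sym (length-++ L1))) e))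
            = refl

  encQ-node : ∀ q ts → Σ ℕ λ x1 → Σ ℕ λ x2 → Σ (List ℕ) λ ys → encQ (node q ts) ≡ 1 ∷ x1 ∷ x2 ∷ ys
  encQ-node (circ k) ts = 1 , k , (length ts ∷ encQL ts) , refl
  encQ-node (gad leaf) ts = 0 , 0 , (length ts ∷ encQL ts) , refl
  encQ-node (gad (node d gs)) ts = 0 , 1 , ((encCDec d ++ (length gs ∷ encCL gs)) ++ (length ts ∷ encQL ts)) , refl


module Shape where
  open Output

  heightL-∷ : ∀ (g : Tree CDec) gs {k} → heightL (g ∷ gs) ≤ k → (height g ≤ k) × (heightL gs ≤ k)
  heightL-∷ g gs le = ≤-trans (m≤m⊔n (height g) (heightL gs)) le , ≤-trans (m≤n⊔m (height g) (heightL gs)) le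

  height0-children : ∀ (cs : List (Tree CDec)) → heightL cs ≤ 0 → MinusFreeL cs × (cLenL cs ≡ length cs) × (leavesL cs ≡ length cs)
  height0-children [] _ = tt , refl , refl
  height0-children (leaf ∷ cs) le with height0-children cs (proj₂ (heightL-∷ leaf cs le))
  ... | a , b , c = (tt , a) , cong suc b , cong suc c
  height0-children (node d x ∷ cs) le with heightL-∷ (node d x) cs le
  ... | () , _

  leafOrPlus⇒MinusFree : ∀ gs → All LeafOrPlus gs → heightL gs ≤ 1 → MinusFreeL gs
  leafOrPlus⇒MinusFree [] _ _ = tt
  leafOrPlus⇒MinusFree (leaf ∷ gs) (_ ∷ lp) le = tt , leafOrPlus⇒MinusFree gs lp (proj₂ (heightL-∷ leaf gs le))
  leafOrPlus⇒MinusFree (node (plus k) cs ∷ gs) (_ ∷ lp) le with heightL-∷ (node (plus k) cs) gs le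
  ... | s≤s h1 , h2 = (tt , proj₁ (height0-children cs h1)) , leafOrPlus⇒MinusFree gs lp h2
  leafOrPlus⇒MinusFree (node (simp _) cs ∷ gs) (() ∷ lp) le
  leafOrPlus⇒MinusFree (node (minus _) cs ∷ gs) (() ∷ lp) le

  mutual
    packed⇒shaped : ∀ {S t} → Packed S t → Shaped t
    packed⇒shaped leafP = tt
    packed⇒shaped (nodeP (circ k) ts v e ps) = packed⇒shapedL ps
    packed⇒shaped (nodeP (gad (node (simp π) gs)) ts (can , s≤s ht , sπ , lp) e ps) = (tt , leafOrPlus⇒MinusFree gs lp ht) , e , packed⇒shapedL ps

    packed⇒shapedL : ∀ {S ts} → All (Packed S) ts → ShapedL ts
    packed⇒shapedL [] = tt
    packed⇒shapedL (p ∷ ps) = packed⇒shaped p , packed⇒shapedL ps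

  leafOrPlus-size : ∀ {S} g → Canonical S g → height g ≤ 1 → LeafOrPlus g → (cLen g ≤ 3 * leaves g) × (1 ≤ leaves g)
  leafOrPlus-size leaf _ _ _ = s≤s z≤n , s≤s z≤n
  leafOrPlus-size (node (plus k) cs) (nodeC _ _ two ek _ _) (s≤s hcs) _ with height0-children cs hcs
  ... | _ , e1 , e2 rewrite e1 | e2 | sym ek = ar k two , ≤-trans (s≤s z≤n) two
    where
    ar : ∀ k → 2 ≤ k → 4 + k ≤ 3 * k
    ar k le = ≤-trans (≤-reflexive (e k)) (≤-trans (+-monoʳ-≤ k (*-monoʳ-≤ 2 le)) (≤-reflexive (f k)))
      where
      e : ∀ k → 4 + k ≡ k + 2 * 2
      e = solve-∀
      f : ∀ k → k + 2 * k ≡ 3 * k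
      f = solve-∀

  leafOrPlus-sizes : ∀ {S} gs → All (Canonical S) gs → heightL gs ≤ 1 → All LeafOrPlus gs →
              (cLenL gs ≤ 3 * leavesL gs) × (length gs ≤ leavesL gs)
  leafOrPlus-sizes [] _ _ _ = z≤n , z≤n
  leafOrPlus-sizes (g ∷ gs) (c ∷ cs) le (l ∷ ls) with leafOrPlus-size g c (proj₁ (heightL-∷ g gs le)) l | leafOrPlus-sizes gs cs (proj₂ (heightL-∷ g gs le)) ls
  ... | a1 , b1 | a2 , b2 =
    subst (_≤ 3 * (leaves g + leavesL gs)) (sym (length-++ (encC g)))
      (subst (cLen g + cLenL gs ≤_) (sym (*-distribˡ-+ 3 (leaves g) (leavesL gs))) (+-mono-≤ a1 a2)) ,
    ≤-trans (s≤s b2) (+-monoˡ-≤ (leavesL gs) b1)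

  gadget-size : ∀ {S} π gs → Canonical S (node (simp π) gs) → heightL gs ≤ 1 → All LeafOrPlus gs →
          cLen (node (simp π) gs) ≤ 4 + 4 * leavesL gs
  gadget-size π gs (nodeC _ _ _ eπ _ cs) ht lp with leafOrPlus-sizes gs cs ht lp
  ... | a , b rewrite length-++ π {length gs ∷ encCL gs} | eπ =
    ≤-trans (≤-reflexive (e (length gs) (cLenL gs))) (≤-trans (+-monoʳ-≤ 4 (+-mono-≤ b a)) (≤-reflexive (f (leavesL gs))))
    where
    e : ∀ a b → 3 + (a + suc b) ≡ 4 + (a + b)
    e = solve-∀
    f : ∀ l → 4 + (l + 3 * l) ≡ 4 + 4 * l
    f = solve-∀

  mutual
    encoding-bound : ∀ {C t} → Packed (SimplesOf C) t → qLen t + 12 ≤ 13 * leaves t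
    encoding-bound leafP = ≤-refl
    encoding-bound (nodeP (circ k) ts two ek ps) =
      ≤-trans (≤-reflexive (e (qLenL ts))) (≤-trans (+-monoʳ-≤ (qLenL ts) (≤-trans (lit16) (*-monoʳ-≤ 12 (subst (2 ≤_) ek two)))) (encoding-boundL ps))
      where
      e : ∀ s → 4 + s + 12 ≡ s + 16
      e = solve-∀
      lit16 : 16 ≤ 12 * 2
      lit16 = ≤ᵇ⇒≤ 16 24 tt
    encoding-bound (nodeP (gad (node (simp π) gs)) ts (can@(nodeC _ _ _ eπ _ cs) , s≤s ht , (_ , three , _) , lp) e ps) =
      subst (λ z → suc (suc z) + 12 ≤ 13 * leavesL ts) (sym (length-++ (encC (node (simp π) gs))))
        (≤-trans (≤-reflexive (e0 (cLen G) (qLenL ts)))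
          (≤-trans (+-monoˡ-≤ (qLenL ts) (+-monoʳ-≤ 15 (gadget-size π gs can ht lp)))
            (≤-trans (≤-reflexive (e1 (leavesL gs) (qLenL ts)))
              (≤-trans (+-monoˡ-≤ (qLenL ts) (+-monoˡ-≤ (4 * leavesL gs) (≤-trans lit19 (*-monoʳ-≤ 8 m3))))
                (≤-trans (≤-reflexive (e2 (leavesL gs) (qLenL ts)))
                  (subst (λ z → qLenL ts + 12 * z ≤ 13 * leavesL ts) (sym e) (encoding-boundL ps)))))))
      where
      G = node (simp π) gs
      e0 : ∀ a b → suc (suc (a + suc b)) + 12 ≡ 15 + a + b
      e0 = solve-∀
      e1 : ∀ l b → 15 + (4 + 4 * l) + b ≡ 19 + 4 * l + b
      e1 = solve-∀
      e2 : ∀ l b → 8 * l + 4 * l + b ≡ b + 12 * l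
      e2 = solve-∀
      lit19 : 19 ≤ 8 * 3
      lit19 = ≤ᵇ⇒≤ 19 24 tt
      m3 : 3 ≤ leavesL gs
      m3 = ≤-trans three (≤-trans (≤-reflexive eπ) (proj₂ (leafOrPlus-sizes gs cs ht lp)))

    encoding-boundL : ∀ {C ts} → All (Packed (SimplesOf C)) ts → qLenL ts + 12 * length ts ≤ 13 * leavesL ts
    encoding-boundL [] = z≤n
    encoding-boundL {ts = t ∷ ts} (p ∷ ps) =
      subst (λ z → z + 12 * suc (length ts) ≤ 13 * (leaves t + leavesL ts)) (sym (length-++ (encQ t)))
        (≤-trans (≤-reflexive (e (qLen t) (qLenL ts) (length ts)))
          (≤-trans (+-mono-≤ (encoding-bound p) (encoding-boundL ps)) (≤-reflexive (sym (*-distribˡ-+ 13 (leaves t) (leavesL ts))))))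
      where
      e : ∀ a b l → a + b + 12 * suc l ≡ (a + 12) + (b + 12 * l)
      e = solve-∀

  encoding-linear : ∀ {C t} → Packed (SimplesOf C) t → qLen t ≤ 13 * leaves t
  encoding-linear {t = t} p = m+n≤o⇒m≤o (qLen t) (encoding-bound p)


module Transducer where

  transducer : Program
  transducer =
    JZ 1 25 ∷
    CONST 1 11 ∷
    ADD 1 1 0 ∷
    STORE 1 3 ∷
    CONST 3 10 ∷
    ADD 3 3 0 ∷
    STORE 3 2 ∷
    CONST 2 1 ∷
    CONST 3 9 ∷
    ADD 3 3 0 ∷
    STORE 3 2 ∷
    CONST 1 4 ∷
    CONST 3 1 ∷
    ADD 3 3 0 ∷
    SUB 3 3 1 ∷
    JZ 3 26 ∷
    CONST 3 8 ∷
    ADD 3 3 0 ∷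
    ADD 3 1 3 ∷
    LOAD 2 1 ∷
    STORE 3 2 ∷
    CONST 3 1 ∷
    ADD 1 3 1 ∷
    CONST 3 0 ∷
    JZ 3 12 ∷
    HALT  ∷
    CONST 7 1 ∷
    ADD 6 7 0 ∷
    ADD 5 0 6 ∷
    CONST 7 8 ∷
    ADD 1 7 5 ∷
    CONST 7 9 ∷
    ADD 2 7 5 ∷
    CONST 7 8 ∷
    ADD 0 7 6 ∷
    CONST 4 0 ∷
    STORE 2 4 ∷
    CONST 6 2 ∷
    ADD 2 6 2 ∷
    STORE 2 4 ∷
    ADD 2 6 2 ∷
    ADD 3 4 0 ∷
    LOAD 5 0 ∷
    JZ 5 82 ∷
    CONST 7 1 ∷
    ADD 6 7 0 ∷
    LOAD 6 6 ∷
    JZ 6 90 ∷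
    CONST 7 1 ∷
    STORE 1 7 ∷
    CONST 7 2 ∷
    ADD 1 7 1 ∷
    CONST 7 2 ∷
    SUB 7 7 4 ∷
    STORE 1 7 ∷
    CONST 7 2 ∷
    ADD 1 7 1 ∷
    CONST 7 2 ∷
    ADD 6 7 0 ∷
    LOAD 6 6 ∷
    STORE 1 6 ∷
    CONST 7 2 ∷
    ADD 1 7 1 ∷
    CONST 7 3 ∷
    ADD 5 7 0 ∷
    LOAD 5 5 ∷
    STORE 1 5 ∷
    CONST 7 2 ∷
    ADD 1 7 1 ∷
    CONST 7 4 ∷
    ADD 0 7 0 ∷
    CONST 7 1 ∷
    SUB 6 7 4 ∷
    CONST 7 3 ∷
    ADD 6 7 6 ∷
    STORE 2 6 ∷
    CONST 7 2 ∷
    ADD 2 7 2 ∷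
    STORE 2 5 ∷
    ADD 2 7 2 ∷
    CONST 7 0 ∷
    JZ 7 177 ∷
    CONST 7 0 ∷
    STORE 1 7 ∷
    CONST 7 2 ∷
    ADD 1 7 1 ∷
    CONST 7 1 ∷
    ADD 0 7 0 ∷
    CONST 7 0 ∷
    JZ 7 177 ∷
    CONST 7 2 ∷
    ADD 3 7 0 ∷
    CONST 7 0 ∷
    ADD 5 7 3 ∷
    CONST 4 1 ∷
    JZ 4 124 ∷
    LOAD 6 5 ∷
    JZ 6 119 ∷
    CONST 7 1 ∷
    ADD 5 7 5 ∷
    LOAD 6 5 ∷
    JZ 6 106 ∷
    CONST 7 2 ∷
    ADD 5 7 5 ∷
    CONST 7 0 ∷
    JZ 7 112 ∷
    CONST 7 1 ∷
    ADD 5 7 5 ∷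
    LOAD 6 5 ∷
    ADD 5 6 5 ∷
    CONST 7 1 ∷
    ADD 5 7 5 ∷
    LOAD 6 5 ∷
    CONST 7 1 ∷
    SUB 4 4 7 ∷
    ADD 4 6 4 ∷
    ADD 5 7 5 ∷
    CONST 7 0 ∷
    JZ 7 95 ∷
    CONST 7 1 ∷
    ADD 5 7 5 ∷
    SUB 4 4 7 ∷
    CONST 7 0 ∷
    JZ 7 95 ∷
    CONST 7 1 ∷
    ADD 0 7 5 ∷
    LOAD 5 3 ∷
    JZ 5 167 ∷
    CONST 7 1 ∷
    STORE 1 7 ∷
    CONST 7 2 ∷
    ADD 1 7 1 ∷
    CONST 7 1 ∷
    ADD 3 7 3 ∷
    LOAD 6 3 ∷
    JZ 6 139 ∷
    CONST 5 2 ∷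
    CONST 7 0 ∷
    JZ 7 144 ∷
    CONST 7 1 ∷
    ADD 6 7 3 ∷
    LOAD 6 6 ∷
    CONST 7 2 ∷
    ADD 5 7 6 ∷
    JZ 5 154 ∷
    LOAD 6 3 ∷
    STORE 1 6 ∷
    CONST 7 2 ∷
    ADD 1 7 1 ∷
    CONST 7 1 ∷
    ADD 3 7 3 ∷
    SUB 5 5 7 ∷
    CONST 7 0 ∷
    JZ 7 144 ∷
    LOAD 5 3 ∷
    STORE 1 5 ∷
    CONST 7 2 ∷
    ADD 1 7 1 ∷
    CONST 7 1 ∷
    ADD 3 7 3 ∷
    STORE 2 7 ∷
    CONST 7 2 ∷
    ADD 2 7 2 ∷
    STORE 2 5 ∷
    ADD 2 7 2 ∷
    CONST 7 0 ∷
    JZ 7 177 ∷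
    CONST 7 1 ∷
    ADD 3 7 3 ∷
    CONST 7 2 ∷
    STORE 2 7 ∷
    ADD 2 7 2 ∷
    STORE 2 3 ∷
    ADD 2 7 2 ∷
    CONST 4 0 ∷
    CONST 7 0 ∷
    JZ 7 42 ∷
    CONST 7 4 ∷
    SUB 5 2 7 ∷
    LOAD 6 5 ∷
    JZ 6 214 ∷
    CONST 7 1 ∷
    SUB 6 6 7 ∷
    JZ 6 198 ∷
    SUB 6 6 7 ∷
    JZ 6 207 ∷
    SUB 6 6 7 ∷
    CONST 7 2 ∷
    SUB 5 2 7 ∷
    LOAD 7 5 ∷
    JZ 7 210 ∷
    CONST 4 0 ∷
    ADD 4 4 6 ∷
    CONST 6 1 ∷
    SUB 7 7 6 ∷
    STORE 5 7 ∷
    CONST 7 0 ∷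
    JZ 7 42 ∷
    CONST 7 2 ∷
    SUB 5 2 7 ∷
    LOAD 7 5 ∷
    JZ 7 210 ∷
    CONST 6 1 ∷
    SUB 7 7 6 ∷
    STORE 5 7 ∷
    CONST 7 0 ∷
    JZ 7 126 ∷
    CONST 7 2 ∷
    SUB 5 2 7 ∷
    LOAD 3 5 ∷
    CONST 7 4 ∷
    SUB 2 2 7 ∷
    CONST 7 0 ∷
    JZ 7 177 ∷
    CONST 5 0 ∷
    CONST 7 0 ∷
    ADD 6 7 0 ∷
    SUB 7 1 6 ∷
    JZ 7 225 ∷
    CONST 7 1 ∷
    ADD 5 7 5 ∷
    CONST 7 2 ∷
    ADD 6 7 6 ∷
    CONST 7 0 ∷
    JZ 7 217 ∷
    CONST 7 2 ∷
    ADD 2 7 0 ∷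
    CONST 7 12 ∷
    ADD 3 7 0 ∷
    CONST 7 0 ∷
    ADD 0 7 5 ∷
    ADD 4 7 1 ∷
    CONST 5 7 ∷
    SUB 1 4 3 ∷
    JZ 1 243 ∷
    LOAD 6 3 ∷
    STORE 5 6 ∷
    CONST 1 1 ∷
    ADD 5 1 5 ∷
    CONST 1 2 ∷
    ADD 3 1 3 ∷
    CONST 1 0 ∷
    JZ 1 233 ∷
    CONST 1 8 ∷
    ADD 6 1 2 ∷
    LOAD 6 6 ∷
    CONST 1 6 ∷
    ADD 5 1 2 ∷
    LOAD 5 5 ∷
    CONST 1 4 ∷
    ADD 4 1 2 ∷
    LOAD 4 4 ∷
    CONST 1 2 ∷
    ADD 3 1 2 ∷
    LOAD 3 3 ∷
    SUB 1 2 1 ∷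
    LOAD 1 1 ∷
    LOAD 2 2 ∷
    HALT  ∷
    []

  pc-shift : ℕ
  pc-shift = 12

  pc-shifted : ℕ
  pc-shifted = 26

  pc-visit : ℕ
  pc-visit = 42

  pc-skip : ℕ
  pc-skip = 95

  pc-skipArity : ℕ
  pc-skipArity = 112

  pc-node : ℕ
  pc-node = 126

  pc-copy : ℕ
  pc-copy = 144

  pc-copied : ℕ
  pc-copied = 154

  pc-return : ℕ
  pc-return = 177

  pc-bottom : ℕ
  pc-bottom = 214

  pc-count : ℕ
  pc-count = 217

  pc-counted : ℕ
  pc-counted = 225

  pc-compact : ℕ
  pc-compact = 233

  pc-compacted : ℕ
  pc-compacted = 243

  pc-halt : ℕ
  pc-halt = 258


module Layout where
  open RAM
  open Transducer
  open Output

  lookupD-++ˡ : ∀ (ys zs : List ℕ) k → k < length ys → lookupD (ys ++ zs) k ≡ lookupD ys k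
  lookupD-++ˡ (y ∷ ys) zs zero lt = refl
  lookupD-++ˡ (y ∷ ys) zs (suc k) (s≤s lt) = lookupD-++ˡ ys zs k lt

  double : ℕ → ℕ
  double zero = zero
  double (suc n) = suc (suc (double n))

  suc-double≢double : ∀ a b → ¬ (suc (double a) ≡ double b)
  suc-double≢double zero (suc zero) ()
  suc-double≢double (suc a) (suc b) e = suc-double≢double a b (suc-injective (suc-injective e))
  suc-double≢double zero (suc (suc b)) ()

  double-mono-< : ∀ {a b} → a < b → double a < double b
  double-mono-< {zero} {suc b} _ = s≤s z≤n
  double-mono-< {suc a} {suc b} (s≤s le) = s≤s (s≤s (double-mono-< le))

  module Machine (xs : List ℕ) (n : ℕ) where
    -- Heap layout after the prologue: input word j at D + j, output word i at E + 2i and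
    -- stack word i at E + 2i + 1.  The output is kept as the reversed list `Or`.
    D : ℕ
    D = suc n
    E : ℕ
    E = n + D

    InputIntact : Heap → Set
    InputIntact h = ∀ j → j < n → h (j + D) ≡ lookupD xs j

    OutputStored : Heap → List ℕ → Set
    OutputStored h [] = ⊤
    OutputStored h (w ∷ Or) = (h (double (length Or) + E) ≡ w) × OutputStored h Or

    StackStored : Heap → List ℕ → Set
    StackStored h [] = ⊤
    StackStored h (w ∷ S) = (h (suc (double (length S)) + E) ≡ w) × StackStored h S

    HeapInv : Heap → List ℕ → List ℕ → Set
    HeapInv h Or S = InputIntact h × OutputStored h Or × StackStored h S

    InputAt : ℕ → List ℕ → Set
    InputAt p ys = ∀ k → k < length ys → (k + p < n) × (lookupD xs (k + p) ≡ lookupD ys k)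

    regState : ℕ → ℕ → ℕ → ℕ → ℕ → ℕ → ℕ → ℕ → ℕ → Heap → State 8
    regState pc r0 r1 r2 r3 r4 r5 r6 r7 h = pc , r0 ∷ r1 ∷ r2 ∷ r3 ∷ r4 ∷ r5 ∷ r6 ∷ r7 ∷ [] , h

    -- Registers: input pointer, output pointer, stack pointer, gadget pointer, the ⊖-flag of
    -- the parent, and three scratch registers.  Heap cell y is memory cell 8 + y.
    cfg : ℕ → ℕ → List ℕ → List ℕ → ℕ → ℕ → ℕ → ℕ → ℕ → Heap → State 8
    cfg pc p Or S g f a b c h =
      regState pc (8 + (p + D)) (8 + (double (length Or) + E)) (8 + (suc (double (length S)) + E)) (8 + (g + D)) f a b c h

    outWrite : Heap → List ℕ → ℕ → Heap
    outWrite h Or v = heapWrite h (double (length Or) + E) v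

    stackWrite : Heap → List ℕ → ℕ → Heap
    stackWrite h S v = heapWrite h (suc (double (length S)) + E) v

    InputIntact-write : ∀ {h} y v → E ≤ y → InputIntact h → InputIntact (heapWrite h y v)
    InputIntact-write {h} y v le inp j j<n =
      trans (heapWrite-miss h y v (j + D) (λ e → <⇒≢ (≤-trans (+-monoˡ-< D j<n) (≤-trans le (≤-reflexive (sym e)))) refl))
            (inp j j<n)

    OutputStored-write : ∀ {h} Or y v → (∀ i → i < length Or → ¬ (y ≡ double i + E)) → OutputStored h Or → OutputStored (heapWrite h y v) Or
    OutputStored-write [] y v ne oi = tt
    OutputStored-write {h} (w ∷ Or) y v ne (e , oi) =
      trans (heapWrite-miss h y v _ (λ e2 → ne (length Or) (s≤s ≤-refl) (sym e2))) e ,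
      OutputStored-write Or y v (λ i lt → ne i (≤-trans lt (n≤1+n _))) oi

    StackStored-write : ∀ {h} S y v → (∀ i → i < length S → ¬ (y ≡ suc (double i) + E)) → StackStored h S → StackStored (heapWrite h y v) S
    StackStored-write [] y v ne si = tt
    StackStored-write {h} (w ∷ S) y v ne (e , si) =
      trans (heapWrite-miss h y v _ (λ e2 → ne (length S) (s≤s ≤-refl) (sym e2))) e ,
      StackStored-write S y v (λ i lt → ne i (≤-trans lt (n≤1+n _))) si

    emit : ∀ {h Or S} v → HeapInv h Or S → HeapInv (heapWrite h (double (length Or) + E) v) (v ∷ Or) S
    emit {h} {Or} {S} v (inp , oi , si) =
      InputIntact-write y v (m≤n+m E (double (length Or))) inp ,
      (heapWrite-hit h y v , OutputStored-write Or y v (λ i lt e → <⇒≢ (double-mono-< lt) (sym (+-cancelʳ-≡ E (double (length Or)) (double i) e))) oi) ,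
      StackStored-write S y v (λ i lt e → suc-double≢double i (length Or) (sym (+-cancelʳ-≡ E (double (length Or)) (suc (double i)) e))) si
      where
      y = double (length Or) + E

    push : ∀ {h Or S} v → HeapInv h Or S → HeapInv (heapWrite h (suc (double (length S)) + E) v) Or (v ∷ S)
    push {h} {Or} {S} v (inp , oi , si) =
      InputIntact-write y v (m≤n+m E (suc (double (length S)))) inp ,
      OutputStored-write Or y v (λ i lt e → suc-double≢double (length S) i (+-cancelʳ-≡ E (suc (double (length S))) (double i) e)) oi ,
      (heapWrite-hit h y v , StackStored-write S y v (λ i lt e → <⇒≢ (double-mono-< lt) (sym (suc-injective (+-cancelʳ-≡ E (suc (double (length S))) (suc (double i)) e)))) si)
      where
      y = suc (double (length S)) + E

    replaceTop : ∀ {h Or S} w v → HeapInv h Or (w ∷ S) → HeapInv (heapWrite h (suc (double (length S)) + E) v) Or (v ∷ S)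
    replaceTop {h} {Or} {S} w v (inp , oi , (_ , si)) = push v (inp , oi , si)

    pop : ∀ {h Or S} w → HeapInv h Or (w ∷ S) → HeapInv h Or S
    pop w (inp , oi , (_ , si)) = inp , oi , si

    top-value : ∀ {h Or S} w → HeapInv h Or (w ∷ S) → h (suc (double (length S)) + E) ≡ w
    top-value w (_ , _ , (e , _)) = e

    OutputStored-ʳ++ : ∀ {h} ys Or → OutputStored h (ys ʳ++ Or) → OutputStored h Or
    OutputStored-ʳ++ [] Or oi = oi
    OutputStored-ʳ++ (y ∷ ys) Or oi = proj₂ (OutputStored-ʳ++ ys (y ∷ Or) oi)

    OutputStored-lookup : ∀ {h} ys Or → OutputStored h (ys ʳ++ Or) → ∀ i → i < length ys → h (double (length Or + i) + E) ≡ lookupD ys i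
    OutputStored-lookup {h} (y ∷ ys) Or oi zero lt = trans (cong (λ z → h (double z + E)) (+-identityʳ (length Or))) (proj₁ (OutputStored-ʳ++ ys (y ∷ Or) oi))
    OutputStored-lookup {h} (y ∷ ys) Or oi (suc i) (s≤s lt) =
      trans (cong (λ z → h (double z + E)) (+-suc (length Or) i)) (OutputStored-lookup ys (y ∷ Or) oi i lt)

    read-input : ∀ {h p y ys} → InputIntact h → InputAt p (y ∷ ys) → h (p + D) ≡ y
    read-input {h} {p} inp at = trans (inp p (proj₁ (at 0 (s≤s z≤n)))) (proj₂ (at 0 (s≤s z≤n)))

    InputAt-tail : ∀ {p y ys} → InputAt p (y ∷ ys) → InputAt (suc p) ys
    InputAt-tail {p} at k lt rewrite +-suc k p = at (suc k) (s≤s lt)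

    InputAt-++ˡ : ∀ {p} ys {zs} → InputAt p (ys ++ zs) → InputAt p ys
    InputAt-++ˡ ys {zs} at k lt with at k (<-≤-trans lt (length-++-≤ˡ ys))
    ... | k+p<n , lookup≡ = k+p<n , trans lookup≡ (lookupD-++ˡ ys zs k lt)

    InputAt-++ʳ : ∀ {p} ys {zs} → InputAt p (ys ++ zs) → InputAt (length ys + p) zs
    InputAt-++ʳ {p} [] at = at
    InputAt-++ʳ {p} (y ∷ ys) {zs} at rewrite sym (+-suc (length ys) p) = InputAt-++ʳ ys (InputAt-tail at)

    InputAt-cong : ∀ {i j ys} → i ≡ j → InputAt i ys → InputAt j ys
    InputAt-cong refl a = a

    visitLeaf : ∀ p Or S g f a b c h → InputIntact h → InputAt p (0 ∷ []) →
      Steps transducer 10 (cfg pc-visit p Or S g f a b c h)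
                 (cfg pc-return (suc p) (0 ∷ Or) S g f 0 b 0 (outWrite h Or 0))
    visitLeaf p Or S g f a b c h inp at =
      compute 1 _ (cfg 43 p Or S g f (h (p + D)) b c h) refl ⟩ rewriteReg 5 0 (read-input {h} inp at) ⟩
      compute 9 _ _ refl

    visitCirc : ∀ k0 a0 rest p Or S g f a b c h → HeapInv h Or S → InputAt p (1 ∷ 1 ∷ k0 ∷ a0 ∷ rest) →
      Steps transducer 40 (cfg pc-visit p Or S g f a b c h)
          (cfg pc-return (4 + p) (a0 ∷ k0 ∷ (2 ∸ f) ∷ 1 ∷ Or) (a0 ∷ (3 + (1 ∸ f)) ∷ S) g f a0 (3 + (1 ∸ f)) 0
            (stackWrite (stackWrite (outWrite (outWrite (outWrite (outWrite h Or 1) (1 ∷ Or) (2 ∸ f)) ((2 ∸ f) ∷ 1 ∷ Or) k0) (k0 ∷ (2 ∸ f) ∷ 1 ∷ Or) a0) S (3 + (1 ∸ f))) ((3 + (1 ∸ f)) ∷ S) a0))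
    visitCirc k0 a0 rest p Or S g f a b c h hi at =
      compute 1 _ (cfg 43 p Or S g f (h (p + D)) b c h) refl ⟩ rewriteReg 5 1 (read-input {h} (proj₁ hi) at) ⟩
      compute 4 _ (cfg 47 p Or S g f 1 (h (suc p + D)) 1 h) refl ⟩ rewriteReg 6 1 (read-input {h} (proj₁ hi) (InputAt-tail at)) ⟩
      compute 13 _ (cfg 60 p ((2 ∸ f) ∷ 1 ∷ Or) S g f 1 (h2 (2 + p + D)) 2 h2) refl ⟩
      rewriteReg 6 k0 (read-input {h2} (proj₁ (emit (2 ∸ f) (emit 1 hi))) (InputAt-tail (InputAt-tail at))) ⟩
      compute 6 _ (cfg 66 p (k0 ∷ (2 ∸ f) ∷ 1 ∷ Or) S g f (h3 (3 + p + D)) k0 3 h3) refl ⟩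
      rewriteReg 5 a0 (read-input {h3} (proj₁ (emit k0 (emit (2 ∸ f) (emit 1 hi)))) (InputAt-tail (InputAt-tail (InputAt-tail at)))) ⟩
      compute 16 _ _ refl
      where
      h2 = outWrite (outWrite h Or 1) (1 ∷ Or) (2 ∸ f)
      h3 = outWrite h2 ((2 ∸ f) ∷ 1 ∷ Or) k0

    -- A stack frame is a counter or pointer on top of a kind: 3 + fc for the remaining
    -- children of a ⊛ vertex whose own flag is fc, 1 for the remaining children of a gadget
    -- vertex, 2 for the gadget pointer to resume at after the subtree hanging at a gadget
    -- leaf, and 0 for the bottom frame.
    returnReadKind : ∀ p Or v t S0 g f a b c h → HeapInv h Or (v ∷ t ∷ S0) →
      Steps transducer 3 (cfg pc-return p Or (v ∷ t ∷ S0) g f a b c h)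
                (cfg 180 p Or (v ∷ t ∷ S0) g f (8 + (suc (double (length S0)) + E)) t 4 h)
    returnReadKind p Or v t S0 g f a b c h hi =
      compute 3 _ (cfg 180 p Or (v ∷ t ∷ S0) g f (8 + (suc (double (length S0)) + E)) (h (suc (double (length S0)) + E)) 4 h) refl ⟩
      rewriteReg 6 t (top-value t (pop v hi))

    returnCircNext : ∀ p Or m fc S0 g f a b c h → HeapInv h Or (suc m ∷ (3 + fc) ∷ S0) →
      Steps transducer 21 (cfg pc-return p Or (suc m ∷ (3 + fc) ∷ S0) g f a b c h)
         (cfg pc-visit p Or (m ∷ (3 + fc) ∷ S0) g fc (8 + (suc (double (suc (length S0))) + E)) 1 0 (stackWrite h ((3 + fc) ∷ S0) m))
    returnCircNext p Or m fc S0 g f a b c h hi =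
      returnReadKind p Or (suc m) (3 + fc) S0 g f a b c h hi ⟩
      compute 10 _ (cfg 190 p Or (suc m ∷ (3 + fc) ∷ S0) g f (8 + (suc (double (suc (length S0))) + E)) fc (h (suc (double (suc (length S0))) + E)) h) refl ⟩
      rewriteReg 7 (suc m) (top-value (suc m) hi) ⟩ compute 8 _ _ refl

    returnCircDone : ∀ p Or fc S0 g f a b c h → HeapInv h Or (0 ∷ (3 + fc) ∷ S0) →
      Steps transducer 18 (cfg pc-return p Or (0 ∷ (3 + fc) ∷ S0) g f a b c h)
         (cfg pc-return p Or S0 g f (8 + (suc (double (suc (length S0))) + E)) fc 0 h)
    returnCircDone p Or fc S0 g f a b c h hi =
      returnReadKind p Or 0 (3 + fc) S0 g f a b c h hi ⟩
      compute 10 _ (cfg 190 p Or (0 ∷ (3 + fc) ∷ S0) g f (8 + (suc (double (suc (length S0))) + E)) fc (h (suc (double (suc (length S0))) + E)) h) refl ⟩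
      rewriteReg 7 0 (top-value 0 hi) ⟩ compute 5 _ _ refl

    returnNodeNext : ∀ p Or m S0 g f a b c h → HeapInv h Or (suc m ∷ 1 ∷ S0) →
      Steps transducer 16 (cfg pc-return p Or (suc m ∷ 1 ∷ S0) g f a b c h)
         (cfg pc-node p Or (m ∷ 1 ∷ S0) g f (8 + (suc (double (suc (length S0))) + E)) 1 0 (stackWrite h (1 ∷ S0) m))
    returnNodeNext p Or m S0 g f a b c h hi =
      returnReadKind p Or (suc m) 1 S0 g f a b c h hi ⟩
      compute 7 _ (cfg 201 p Or (suc m ∷ 1 ∷ S0) g f (8 + (suc (double (suc (length S0))) + E)) 0 (h (suc (double (suc (length S0))) + E)) h) refl ⟩
      rewriteReg 7 (suc m) (top-value (suc m) hi) ⟩ compute 6 _ _ refl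

    returnNodeDone : ∀ p Or S0 g f a b c h → HeapInv h Or (0 ∷ 1 ∷ S0) →
      Steps transducer 15 (cfg pc-return p Or (0 ∷ 1 ∷ S0) g f a b c h)
         (cfg pc-return p Or S0 g f (8 + (suc (double (suc (length S0))) + E)) 0 0 h)
    returnNodeDone p Or S0 g f a b c h hi =
      returnReadKind p Or 0 1 S0 g f a b c h hi ⟩
      compute 7 _ (cfg 201 p Or (0 ∷ 1 ∷ S0) g f (8 + (suc (double (suc (length S0))) + E)) 0 (h (suc (double (suc (length S0))) + E)) h) refl ⟩
      rewriteReg 7 0 (top-value 0 hi) ⟩ compute 5 _ _ refl

    returnGadgetLeaf : ∀ p Or g1 S0 g f a b c h → HeapInv h Or ((8 + (g1 + D)) ∷ 2 ∷ S0) →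
      Steps transducer 16 (cfg pc-return p Or ((8 + (g1 + D)) ∷ 2 ∷ S0) g f a b c h)
         (cfg pc-return p Or S0 g1 f (8 + (suc (double (suc (length S0))) + E)) 0 0 h)
    returnGadgetLeaf p Or g1 S0 g f a b c h hi =
      returnReadKind p Or (8 + (g1 + D)) 2 S0 g f a b c h hi ⟩
      compute 9 _ (regState 210 (8 + (p + D)) (8 + (double (length Or) + E)) (8 + (suc (double (length ((8 + (g1 + D)) ∷ 2 ∷ S0))) + E))
                    (h (suc (double (suc (length S0))) + E)) f (8 + (suc (double (suc (length S0))) + E)) 0 2 h) refl ⟩
      rewriteReg 3 (8 + (g1 + D)) (top-value (8 + (g1 + D)) hi) ⟩ compute 4 _ _ refl

    returnBottom : ∀ p Or g f a b c h → HeapInv h Or (0 ∷ 0 ∷ []) →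
      Steps transducer 4 (cfg pc-return p Or (0 ∷ 0 ∷ []) g f a b c h)
         (cfg pc-bottom p Or (0 ∷ 0 ∷ []) g f (8 + (suc (double 0) + E)) 0 4 h)
    returnBottom p Or g f a b c h hi = returnReadKind p Or 0 0 [] g f a b c h hi ⟩ compute 1 _ _ refl

    gadgetLeaf : ∀ rest p Or S g0 f a b c h → InputIntact h → InputAt g0 (0 ∷ rest) →
      Steps transducer 12 (cfg pc-node p Or S g0 f a b c h)
         (cfg pc-visit p Or ((8 + (suc g0 + D)) ∷ 2 ∷ S) (suc g0) 0 0 b 0 (stackWrite (stackWrite h S 2) (2 ∷ S) (8 + (suc g0 + D))))
    gadgetLeaf rest p Or S g0 f a b c h inp at =
      compute 1 _ (cfg 127 p Or S g0 f (h (g0 + D)) b c h) refl ⟩ rewriteReg 5 0 (read-input {h} inp at) ⟩ compute 11 _ _ refl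

    record NodeHeader (d : CDec) (p : ℕ) (Or S : List ℕ) (g0 f a b c : ℕ) (h : Heap) : Set where
      constructor mkNodeHeader
      field
        cost b′ c′ : ℕ
        cost-bound : cost ≤ 15
        steps : Steps transducer cost (cfg pc-node p Or S g0 f a b c h) (cfg pc-copy p (1 ∷ Or) S (suc g0) f (length (encCDec d)) b′ c′ (outWrite h Or 1))

    nodeHeader : ∀ d rest p Or S g0 f a b c h → HeapInv h Or S → InputAt g0 (1 ∷ encCDec d ++ rest) → NodeHeader d p Or S g0 f a b c h
    nodeHeader (simp π) rest p Or S g0 f a b c h hi at =
      mkNodeHeader 15 _ _ ≤-refl
       (compute 1 _ (cfg 127 p Or S g0 f (h (g0 + D)) b c h) refl ⟩ rewriteReg 5 1 (read-input {h} (proj₁ hi) at) ⟩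
        compute 8 _ (cfg 135 p (1 ∷ Or) S (suc g0) f 1 (h1 (suc g0 + D)) 1 h1) refl ⟩
        rewriteReg 6 0 (read-input {h1} (proj₁ (emit 1 hi)) (InputAt-tail at)) ⟩
        compute 4 _ (cfg 142 p (1 ∷ Or) S (suc g0) f 1 (h1 (2 + g0 + D)) 1 h1) refl ⟩
        rewriteReg 6 (length π) (read-input {h1} (proj₁ (emit 1 hi)) (InputAt-tail (InputAt-tail at))) ⟩ compute 2 _ _ refl)
      where
      h1 = outWrite h Or 1
    nodeHeader (plus k) rest p Or S g0 f a b c h hi at =
      mkNodeHeader 13 _ _ (≤ᵇ⇒≤ 13 15 tt)
       (compute 1 _ (cfg 127 p Or S g0 f (h (g0 + D)) b c h) refl ⟩ rewriteReg 5 1 (read-input {h} (proj₁ hi) at) ⟩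
        compute 8 _ (cfg 135 p (1 ∷ Or) S (suc g0) f 1 (h1 (suc g0 + D)) 1 h1) refl ⟩
        rewriteReg 6 1 (read-input {h1} (proj₁ (emit 1 hi)) (InputAt-tail at)) ⟩ compute 4 _ _ refl)
      where
      h1 = outWrite h Or 1
    nodeHeader (minus k) rest p Or S g0 f a b c h hi at =
      mkNodeHeader 13 _ _ (≤ᵇ⇒≤ 13 15 tt)
       (compute 1 _ (cfg 127 p Or S g0 f (h (g0 + D)) b c h) refl ⟩ rewriteReg 5 1 (read-input {h} (proj₁ hi) at) ⟩
        compute 8 _ (cfg 135 p (1 ∷ Or) S (suc g0) f 1 (h1 (suc g0 + D)) 1 h1) refl ⟩
        rewriteReg 6 2 (read-input {h1} (proj₁ (emit 1 hi)) (InputAt-tail at)) ⟩ compute 4 _ _ refl)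
      where
      h1 = outWrite h Or 1

    nodeArity : ∀ v rest p Or S g f b c h → InputIntact h → InputAt g (v ∷ rest) →
      Steps transducer 13 (cfg pc-copied p Or S g f 0 b c h)
         (cfg pc-return p (v ∷ Or) (v ∷ 1 ∷ S) (suc g) f v b 0 (stackWrite (stackWrite (outWrite h Or v) S 1) (1 ∷ S) v))
    nodeArity v rest p Or S g f b c h inp at =
      compute 1 _ (cfg 155 p Or S g f (h (g + D)) b c h) refl ⟩ rewriteReg 5 v (read-input {h} inp at) ⟩ compute 12 _ _ refl

    visitGadget : ∀ rest p Or S g f a b c h → InputIntact h → InputAt p (1 ∷ 0 ∷ rest) →
      Steps transducer 11 (cfg pc-visit p Or S g f a b c h) (cfg pc-skip p Or S (2 + p) 1 (8 + (2 + p + D)) 0 0 h)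
    visitGadget rest p Or S g f a b c h inp at =
      compute 1 _ (cfg 43 p Or S g f (h (p + D)) b c h) refl ⟩ rewriteReg 5 1 (read-input {h} inp at) ⟩
      compute 4 _ (cfg 47 p Or S g f 1 (h (suc p + D)) 1 h) refl ⟩ rewriteReg 6 0 (read-input {h} inp (InputAt-tail at)) ⟩
      compute 6 _ _ refl

    skipLeaf : ∀ x p Or S gq c b k h → InputIntact h → InputAt x (0 ∷ []) →
      Steps transducer 8 (cfg pc-skip p Or S gq (suc c) (8 + (x + D)) b k h) (cfg pc-skip p Or S gq c (8 + (suc x + D)) 0 0 h)
    skipLeaf x p Or S gq c b k h inp at =
      compute 2 _ (cfg 97 p Or S gq (suc c) (8 + (x + D)) (h (x + D)) k h) refl ⟩ rewriteReg 6 0 (read-input {h} inp at) ⟩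
      compute 6 _ _ refl

    skipArity : ∀ v rest y p Or S gq c b k h → InputIntact h → InputAt y (v ∷ rest) →
      Steps transducer 7 (cfg pc-skipArity p Or S gq (suc c) (8 + (y + D)) b k h) (cfg pc-skip p Or S gq (v + c) (8 + (suc y + D)) v 0 h)
    skipArity v rest y p Or S gq c b k h inp at =
      compute 1 _ (cfg 113 p Or S gq (suc c) (8 + (y + D)) (h (y + D)) k h) refl ⟩ rewriteReg 6 v (read-input {h} inp at) ⟩
      compute 6 _ _ refl

    skipEnd : ∀ X p Or S gq b k h →
      Steps transducer 3 (cfg pc-skip p Or S gq 0 (8 + (X + D)) b k h) (cfg pc-node (suc X) Or S gq 0 (8 + (X + D)) b 1 h)
    skipEnd X p Or S gq b k h = compute 3 _ _ refl

    record SkipHeader (d : CDec) (x p : ℕ) (Or S : List ℕ) (gq c b k : ℕ) (h : Heap) : Set where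
      constructor mkSkipHeader
      field
        cost b′ c′ : ℕ
        cost-bound : cost ≤ 13
        steps : Steps transducer cost (cfg pc-skip p Or S gq (suc c) (8 + (x + D)) b k h)
                          (cfg pc-skipArity p Or S gq (suc c) (8 + (suc (length (encCDec d)) + x + D)) b′ c′ h)

    skipHeader : ∀ d rest x p Or S gq c b k h → InputIntact h → InputAt x (1 ∷ encCDec d ++ rest) → SkipHeader d x p Or S gq c b k h
    skipHeader (simp π) rest x p Or S gq c b k h inp at =
      mkSkipHeader 13 _ _ ≤-refl
       (compute 2 _ (cfg 97 p Or S gq (suc c) (8 + (x + D)) (h (x + D)) k h) refl ⟩ rewriteReg 6 1 (read-input {h} inp at) ⟩
        compute 4 _ (cfg 101 p Or S gq (suc c) (8 + (suc x + D)) (h (suc x + D)) 1 h) refl ⟩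
        rewriteReg 6 0 (read-input {h} inp (InputAt-tail at)) ⟩
        compute 4 _ (cfg 109 p Or S gq (suc c) (8 + (2 + x + D)) (h (2 + x + D)) 1 h) refl ⟩
        rewriteReg 6 (length π) (read-input {h} inp (InputAt-tail (InputAt-tail at))) ⟩
        compute 1 _ (cfg 110 p Or S gq (suc c) (length π + (8 + (2 + x + D))) (length π) 1 h) refl ⟩
        rewriteReg 5 (8 + (2 + length π + x + D)) (ar (length π) x D) ⟩ compute 2 _ _ refl)
      where
      ar : ∀ a x D → a + (8 + (suc (suc x) + D)) ≡ 8 + (suc (suc a) + x + D)
      ar = solve-∀
    skipHeader (plus k0) rest x p Or S gq c b k h inp at =
      mkSkipHeader 11 _ _ (≤ᵇ⇒≤ 11 13 tt)
       (compute 2 _ (cfg 97 p Or S gq (suc c) (8 + (x + D)) (h (x + D)) k h) refl ⟩ rewriteReg 6 1 (read-input {h} inp at) ⟩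
        compute 4 _ (cfg 101 p Or S gq (suc c) (8 + (suc x + D)) (h (suc x + D)) 1 h) refl ⟩
        rewriteReg 6 1 (read-input {h} inp (InputAt-tail at)) ⟩ compute 5 _ _ refl)
    skipHeader (minus k0) rest x p Or S gq c b k h inp at =
      mkSkipHeader 11 _ _ (≤ᵇ⇒≤ 11 13 tt)
       (compute 2 _ (cfg 97 p Or S gq (suc c) (8 + (x + D)) (h (x + D)) k h) refl ⟩ rewriteReg 6 1 (read-input {h} inp at) ⟩
        compute 4 _ (cfg 101 p Or S gq (suc c) (8 + (suc x + D)) (h (suc x + D)) 1 h) refl ⟩
        rewriteReg 6 2 (read-input {h} inp (InputAt-tail at)) ⟩ compute 5 _ _ refl)

    copyCost : List ℕ → ℕ
    copyCost [] = 1
    copyCost (w ∷ ws) = 10 + copyCost ws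

    advance : List ℕ → ℕ → ℕ
    advance [] g = g
    advance (w ∷ ws) g = advance ws (suc g)

    record CopyRun (ws : List ℕ) (p : ℕ) (Or S : List ℕ) (g f b c : ℕ) (h : Heap) : Set where
      constructor mkCopyRun
      field
        b′ c′ : ℕ
        h′ : Heap
        invariant : HeapInv h′ (ws ʳ++ Or) S
        steps : Steps transducer (copyCost ws) (cfg pc-copy p Or S g f (length ws) b c h) (cfg pc-copied p (ws ʳ++ Or) S (advance ws g) f 0 b′ c′ h′)

    copyWords : ∀ ws p Or S g f b c h → HeapInv h Or S → InputAt g ws → CopyRun ws p Or S g f b c h
    copyWords [] p Or S g f b c h hi at = mkCopyRun b c h hi (compute 1 _ _ refl)
    copyWords (w ∷ ws) p Or S g f b c h hi at =
      mkCopyRun (CopyRun.b′ r) (CopyRun.c′ r) (CopyRun.h′ r) (CopyRun.invariant r)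
        (compute 2 _ (cfg 146 p Or S g f (suc (length ws)) (h (g + D)) c h) refl ⟩ rewriteReg 6 w (read-input {h} (proj₁ hi) at) ⟩
         compute 8 _ (cfg pc-copy p (w ∷ Or) S (suc g) f (length ws) w 0 (outWrite h Or w)) refl ⟩ CopyRun.steps r)
      where
      r = copyWords ws p (w ∷ Or) S (suc g) f w 0 (outWrite h Or w) (emit w hi) (InputAt-tail at)


module Skip where
  open RAM
  open Transducer
  open Output
  open Layout

  module Skipping (xs : List ℕ) (n : ℕ) where
    open Machine xs n

    retarget : ∀ {k} {s : State 8} {pc p1 p2 O1 O2 S g1 g2 f a b c h} → p1 ≡ p2 → O1 ≡ O2 → g1 ≡ g2 →
            Steps transducer k s (cfg pc p1 O1 S g1 f a b c h) → Steps transducer k s (cfg pc p2 O2 S g2 f a b c h)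
    retarget refl refl refl r = r

    advance≡+ : ∀ ws g → advance ws g ≡ length ws + g
    advance≡+ [] g = refl
    advance≡+ (w ∷ ws) g = trans (advance≡+ ws (suc g)) (+-suc (length ws) g)

    -- Skipping needs no stack: register 4 counts the subtrees of the gadget still to be
    -- skipped; each vertex decrements it and adds its arity.
    record SkipTree (g : Tree CDec) (x p : ℕ) (Or S : List ℕ) (gq c b k : ℕ) (h : Heap) : Set where
      constructor mkSkipTree
      field
        cost b′ k′ : ℕ
        cost-bound : cost ≤ 8 * cLen g
        steps : Steps transducer cost (cfg pc-skip p Or S gq (suc c) (8 + (x + D)) b k h)
                          (cfg pc-skip p Or S gq c (8 + (cLen g + x + D)) b′ k′ h)

    record SkipForest (gs : List (Tree CDec)) (x p : ℕ) (Or S : List ℕ) (gq c b k : ℕ) (h : Heap) : Set where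
      constructor mkSkipForest
      field
        cost b′ k′ : ℕ
        cost-bound : cost ≤ 8 * cLenL gs
        steps : Steps transducer cost (cfg pc-skip p Or S gq (length gs + c) (8 + (x + D)) b k h)
                          (cfg pc-skip p Or S gq c (8 + (cLenL gs + x + D)) b′ k′ h)

    2≤length-encCDec : ∀ d → 2 ≤ length (encCDec d)
    2≤length-encCDec (simp π) = s≤s (s≤s z≤n)
    2≤length-encCDec (plus k) = s≤s (s≤s z≤n)
    2≤length-encCDec (minus k) = s≤s (s≤s z≤n)

    cost-skipNode : ∀ a l s → a ≤ 13 → 2 ≤ l → a + (7 + 8 * s) ≤ 8 * suc (l + suc s)
    cost-skipNode a l s ha hl = begin
        a + (7 + 8 * s)        ≤⟨ +-monoˡ-≤ (7 + 8 * s) ha ⟩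
        13 + (7 + 8 * s)       ≤⟨ +-monoˡ-≤ (7 + 8 * s) (≤ᵇ⇒≤ 13 25 tt) ⟩
        25 + (7 + 8 * s)       ≡⟨ e1 s ⟩
        8 * suc (2 + suc s)    ≤⟨ *-monoʳ-≤ 8 (s≤s (+-monoˡ-≤ (suc s) hl)) ⟩
        8 * suc (l + suc s)    ∎
      where
      open ≤-Reasoning
      e1 : ∀ s → 25 + (7 + 8 * s) ≡ 8 * suc (2 + suc s)
      e1 = solve-∀

    mutual
      skipTree : ∀ g x p Or S gq c b k h → InputIntact h → InputAt x (encC g) → SkipTree g x p Or S gq c b k h
      skipTree leaf x p Or S gq c b k h inp at = mkSkipTree 8 0 0 ≤-refl (skipLeaf x p Or S gq c b k h inp at)
      skipTree (node d cs) x p Or S gq c b k h inp at =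
        mkSkipTree (SkipHeader.cost H + (7 + SkipForest.cost L)) (SkipForest.b′ L) (SkipForest.k′ L)
            (subst (λ z → SkipHeader.cost H + (7 + SkipForest.cost L) ≤ 8 * suc z) (sym (length-++ ws))
               (≤-trans (+-monoʳ-≤ (SkipHeader.cost H) (+-monoʳ-≤ 7 (SkipForest.cost-bound L)))
                        (cost-skipNode (SkipHeader.cost H) (length ws) (cLenL cs) (SkipHeader.cost-bound H) (2≤length-encCDec d))))
            (SkipHeader.steps H ⟩ skipArity (length cs) (encCL cs) y p Or S gq c (SkipHeader.b′ H) (SkipHeader.c′ H) h inp at2 ⟩
             subst (λ z → Steps transducer (SkipForest.cost L) (cfg pc-skip p Or S gq (length cs + c) (8 + (suc y + D)) (length cs) 0 h) (cfg pc-skip p Or S gq c (8 + (z + D)) (SkipForest.b′ L) (SkipForest.k′ L) h)) eX (SkipForest.steps L))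
        where
        ws = encCDec d
        y = suc (length ws) + x
        H = skipHeader d (length cs ∷ encCL cs) x p Or S gq c b k h inp at
        at2 : InputAt y (length cs ∷ encCL cs)
        at2 = InputAt-cong (+-suc (length ws) x) (InputAt-++ʳ ws (InputAt-tail at))
        L = skipForest cs (suc y) p Or S gq c (length cs) 0 h inp (InputAt-tail at2)
        eX : cLenL cs + suc y ≡ cLen (node d cs) + x
        eX = trans (e0 (cLenL cs) (length ws) x) (cong (λ z → suc z + x) (sym (length-++ ws)))
          where
          e0 : ∀ s l x → s + suc (suc l + x) ≡ suc (l + suc s) + x
          e0 = solve-∀

      skipForest : ∀ gs x p Or S gq c b k h → InputIntact h → InputAt x (encCL gs) → SkipForest gs x p Or S gq c b k h
      skipForest [] x p Or S gq c b k h inp at = mkSkipForest 0 b k z≤n (compute 0 _ _ refl)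
      skipForest (g ∷ gs) x p Or S gq c b k h inp at =
        mkSkipForest (SkipTree.cost T + SkipForest.cost L) (SkipForest.b′ L) (SkipForest.k′ L)
          (subst (λ z → SkipTree.cost T + SkipForest.cost L ≤ 8 * z) (sym (length-++ (encC g)))
            (≤-trans (+-mono-≤ (SkipTree.cost-bound T) (SkipForest.cost-bound L)) (≤-reflexive (sym (*-distribˡ-+ 8 (cLen g) (cLenL gs))))))
          (SkipTree.steps T ⟩ subst (λ z → Steps transducer (SkipForest.cost L) (cfg pc-skip p Or S gq (length gs + c) (8 + (cLen g + x + D)) (SkipTree.b′ T) (SkipTree.k′ T) h) (cfg pc-skip p Or S gq c (8 + (z + D)) (SkipForest.b′ L) (SkipForest.k′ L) h)) eX (SkipForest.steps L))
        where
        T = skipTree g x p Or S gq (length gs + c) b k h inp (InputAt-++ˡ (encC g) at)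
        L = skipForest gs (cLen g + x) p Or S gq c (SkipTree.b′ T) (SkipTree.k′ T) h inp (InputAt-++ʳ (encC g) at)
        eX : cLenL gs + (cLen g + x) ≡ cLenL (g ∷ gs) + x
        eX = trans (e0 (cLenL gs) (cLen g) x) (cong (_+ x) (sym (length-++ (encC g))))
          where
          e0 : ∀ s t x → s + (t + x) ≡ t + s + x
          e0 = solve-∀

    cost-circChild : ∀ kq kr s1 s2 → kq + 30 ≤ 100 * s1 → kr ≤ 18 + 100 * s2 → 21 + (kq + kr) ≤ 18 + 100 * (s1 + s2)
    cost-circChild kq kr s1 s2 h1 h2 = begin
        21 + (kq + kr)               ≤⟨ +-monoʳ-≤ 21 (+-monoʳ-≤ kq h2) ⟩
        21 + (kq + (18 + 100 * s2))  ≡⟨ e kq s2 ⟩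
        (kq + 30) + (9 + 100 * s2)   ≤⟨ +-monoˡ-≤ (9 + 100 * s2) h1 ⟩
        100 * s1 + (9 + 100 * s2)    ≤⟨ ≤-reflexive (f s1 s2) ⟩
        9 + 100 * (s1 + s2)          ≤⟨ +-monoˡ-≤ (100 * (s1 + s2)) (≤ᵇ⇒≤ 9 18 tt) ⟩
        18 + 100 * (s1 + s2)         ∎
      where
      open ≤-Reasoning
      e : ∀ kq s2 → 21 + (kq + (18 + 100 * s2)) ≡ (kq + 30) + (9 + 100 * s2)
      e = solve-∀
      f : ∀ s1 s2 → 100 * s1 + (9 + 100 * s2) ≡ 9 + 100 * (s1 + s2)
      f = solve-∀

    cost-circ : ∀ kr s → kr ≤ 18 + 100 * s → (40 + kr) + 30 ≤ 100 * (4 + s)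
    cost-circ kr s h = begin
        (40 + kr) + 30               ≤⟨ +-monoˡ-≤ 30 (+-monoʳ-≤ 40 h) ⟩
        (40 + (18 + 100 * s)) + 30   ≡⟨ e s ⟩
        88 + 100 * s                 ≤⟨ +-monoˡ-≤ (100 * s) (≤ᵇ⇒≤ 88 400 tt) ⟩
        400 + 100 * s                ≡⟨ f s ⟩
        100 * (4 + s)                ∎
      where
      open ≤-Reasoning
      e : ∀ s → (40 + (18 + 100 * s)) + 30 ≡ 88 + 100 * s
      e = solve-∀
      f : ∀ s → 400 + 100 * s ≡ 100 * (4 + s)
      f = solve-∀

    cost-gadget : ∀ ks kc sG sL → ks ≤ 8 * sG → kc + 30 ≤ 90 * sG + 100 * sL →
           (11 + (ks + (3 + kc))) + 30 ≤ 100 * (2 + (sG + suc sL))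
    cost-gadget ks kc sG sL h1 h2 = begin
        (11 + (ks + (3 + kc))) + 30         ≡⟨ e ks kc ⟩
        14 + (ks + (kc + 30))               ≤⟨ +-monoʳ-≤ 14 (+-mono-≤ h1 h2) ⟩
        14 + (8 * sG + (90 * sG + 100 * sL)) ≤⟨ ≤-reflexive (f sG sL) ⟩
        14 + (98 * sG + 100 * sL)           ≤⟨ +-mono-≤ (≤ᵇ⇒≤ 14 300 tt) (+-monoˡ-≤ (100 * sL) (*-monoˡ-≤ sG (≤ᵇ⇒≤ 98 100 tt))) ⟩
        300 + (100 * sG + 100 * sL)         ≡⟨ g sG sL ⟩
        100 * (2 + (sG + suc sL))           ∎
      where
      open ≤-Reasoning
      e : ∀ ks kc → (11 + (ks + (3 + kc))) + 30 ≡ 14 + (ks + (kc + 30))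
      e = solve-∀
      f : ∀ sG sL → 14 + (8 * sG + (90 * sG + 100 * sL)) ≡ 14 + (98 * sG + 100 * sL)
      f = solve-∀
      g : ∀ sG sL → 300 + (100 * sG + 100 * sL) ≡ 100 * (2 + (sG + suc sL))
      g = solve-∀

    copyCost≡ : ∀ ws → copyCost ws ≡ 1 + 10 * length ws
    copyCost≡ [] = refl
    copyCost≡ (w ∷ ws) = trans (cong (10 +_) (copyCost≡ ws)) (e (length ws))
      where
      e : ∀ l → 10 + (1 + 10 * l) ≡ 1 + 10 * suc l
      e = solve-∀

    cost-gadgetNode : ∀ kh cw kn l sGL sL → kh ≤ 15 → cw ≡ 1 + 10 * l → kn ≤ 15 + 90 * sGL + 100 * sL →
          kh + (cw + (13 + kn)) + 30 ≤ 90 * suc (l + suc sGL) + 100 * sL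
    cost-gadgetNode kh cw kn l sGL sL h1 refl h3 = begin
        kh + ((1 + 10 * l) + (13 + kn)) + 30          ≤⟨ +-monoˡ-≤ 30 (+-mono-≤ h1 (+-monoʳ-≤ (1 + 10 * l) (+-monoʳ-≤ 13 h3))) ⟩
        15 + ((1 + 10 * l) + (13 + (15 + 90 * sGL + 100 * sL))) + 30 ≡⟨ e l sGL sL ⟩
        74 + 10 * l + 90 * sGL + 100 * sL             ≤⟨ +-monoˡ-≤ (100 * sL) (+-monoˡ-≤ (90 * sGL) (+-mono-≤ (≤ᵇ⇒≤ 74 180 tt) (*-monoˡ-≤ l (≤ᵇ⇒≤ 10 90 tt)))) ⟩
        180 + 90 * l + 90 * sGL + 100 * sL            ≡⟨ f l sGL sL ⟩
        90 * suc (l + suc sGL) + 100 * sL             ∎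
      where
      open ≤-Reasoning
      e : ∀ l sGL sL → 15 + ((1 + 10 * l) + (13 + (15 + 90 * sGL + 100 * sL))) + 30 ≡ 74 + 10 * l + 90 * sGL + 100 * sL
      e = solve-∀
      f : ∀ l sGL sL → 180 + 90 * l + 90 * sGL + 100 * sL ≡ 90 * suc (l + suc sGL) + 100 * sL
      f = solve-∀

    cost-leafChild : ∀ kq kn sT sGL sL → kq + 30 ≤ 100 * sT → kn ≤ 15 + 90 * sGL + 100 * sL →
             16 + (12 + (kq + (16 + kn))) ≤ 15 + 90 * suc sGL + 100 * (sT + sL)
    cost-leafChild kq kn sT sGL sL h1 h2 = begin
        16 + (12 + (kq + (16 + kn)))               ≤⟨ +-monoʳ-≤ 16 (+-monoʳ-≤ 12 (+-monoʳ-≤ kq (+-monoʳ-≤ 16 h2))) ⟩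
        16 + (12 + (kq + (16 + (15 + 90 * sGL + 100 * sL)))) ≡⟨ e kq sGL sL ⟩
        (kq + 30) + (29 + 90 * sGL + 100 * sL)     ≤⟨ +-monoˡ-≤ (29 + 90 * sGL + 100 * sL) h1 ⟩
        100 * sT + (29 + 90 * sGL + 100 * sL)      ≤⟨ +-monoʳ-≤ (100 * sT) (+-monoˡ-≤ (100 * sL) (+-monoˡ-≤ (90 * sGL) (≤ᵇ⇒≤ 29 105 tt))) ⟩
        100 * sT + (105 + 90 * sGL + 100 * sL)     ≡⟨ f sT sGL sL ⟩
        15 + 90 * suc sGL + 100 * (sT + sL)        ∎
      where
      open ≤-Reasoning
      e : ∀ kq sGL sL → 16 + (12 + (kq + (16 + (15 + 90 * sGL + 100 * sL)))) ≡ (kq + 30) + (29 + 90 * sGL + 100 * sL)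
      e = solve-∀
      f : ∀ sT sGL sL → 100 * sT + (105 + 90 * sGL + 100 * sL) ≡ 15 + 90 * suc sGL + 100 * (sT + sL)
      f = solve-∀

    cost-nodeChild : ∀ kc kn sG sL1 sGL sL2 → kc + 30 ≤ 90 * sG + 100 * sL1 → kn ≤ 15 + 90 * sGL + 100 * sL2 →
             16 + (kc + kn) ≤ 15 + 90 * (sG + sGL) + 100 * (sL1 + sL2)
    cost-nodeChild kc kn sG sL1 sGL sL2 h1 h2 = begin
        16 + (kc + kn)                                  ≤⟨ +-monoʳ-≤ 16 (+-monoʳ-≤ kc h2) ⟩
        16 + (kc + (15 + 90 * sGL + 100 * sL2))         ≡⟨ e kc sGL sL2 ⟩
        (kc + 30) + (1 + 90 * sGL + 100 * sL2)          ≤⟨ +-monoˡ-≤ (1 + 90 * sGL + 100 * sL2) h1 ⟩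
        (90 * sG + 100 * sL1) + (1 + 90 * sGL + 100 * sL2) ≤⟨ ≤-reflexive (f sG sL1 sGL sL2) ⟩
        1 + 90 * (sG + sGL) + 100 * (sL1 + sL2)         ≤⟨ +-monoˡ-≤ (100 * (sL1 + sL2)) (+-monoˡ-≤ (90 * (sG + sGL)) (≤ᵇ⇒≤ 1 15 tt)) ⟩
        15 + 90 * (sG + sGL) + 100 * (sL1 + sL2)        ∎
      where
      open ≤-Reasoning
      e : ∀ kc sGL sL2 → 16 + (kc + (15 + 90 * sGL + 100 * sL2)) ≡ (kc + 30) + (1 + 90 * sGL + 100 * sL2)
      e = solve-∀
      f : ∀ sG sL1 sGL sL2 → (90 * sG + 100 * sL1) + (1 + 90 * sGL + 100 * sL2) ≡ 1 + 90 * (sG + sGL) + 100 * (sL1 + sL2)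
      f = solve-∀


module Correct where
  open RAM
  open Transducer
  open Output
  open Layout
  open Skip

  out-circ : ∀ pp k0 ts → out pp (node (circ k0) ts) ≡
    1 ∷ (2 ∸ minusFlag pp) ∷ k0 ∷ length ts ∷ encCL (resolveL (just (resolveDec pp (circI k0))) (expandL ts))
  out-circ pp k0 ts rewrite encCDec-resolveCirc pp k0 | length-resolveL (just (resolveDec pp (circI k0))) (expandL ts) | length-expandL ts = refl

  outChildren-node : ∀ d d′ cs gs ts1 ts2 → length ts1 ≡ leavesL cs →
               outChildren d (node d′ cs ∷ gs) (ts1 ++ ts2) ≡ outNode d′ cs ts1 ++ outChildren d gs ts2
  outChildren-node d d′ cs gs ts1 ts2 e = cong (λ z → encCL (resolveL (just d) z)) lem
    where
    E1 = expandL ts1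
    E2 = expandL ts2
    lem : proj₁ (graftL (node d′ cs ∷ gs) (expandL (ts1 ++ ts2))) ≡ proj₁ (graft (node d′ cs) E1) ∷ proj₁ (graftL gs E2)
    lem rewrite expandL-++ ts1 ts2 | graftL-++ cs E1 E2 (trans (length-expandL ts1) e) = refl

  module Correctness (xs : List ℕ) (n : ℕ) where
    open Machine xs n
    open Skipping xs n

    -- The slack of 30 steps in `cost-bound` pays for the stack-frame bookkeeping of the caller.
    record TreeRun (t : Tree QDec) (pp : Maybe CDec) (p : ℕ) (Or S : List ℕ) (g a b c : ℕ) (h : Heap) : Set where
      constructor mkTreeRun
      field
        cost g′ f′ a′ b′ c′ : ℕ
        h′ : Heap
        cost-bound : cost + 30 ≤ 100 * qLen t
        out-bound : length (out pp t) ≤ qLen t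
        invariant : HeapInv h′ (out pp t ʳ++ Or) S
        steps : Steps transducer cost (cfg pc-visit p Or S g (minusFlag pp) a b c h) (cfg pc-return (qLen t + p) (out pp t ʳ++ Or) S g′ f′ a′ b′ c′ h′)

    TreeSpec : Tree QDec → Set
    TreeSpec t = ∀ pp p Or S g a b c h → HeapInv h Or S → InputAt p (encQ t) → TreeRun t pp p Or S g a b c h

    record CircChildrenRun (dc : CDec) (ts : List (Tree QDec)) (fc p : ℕ) (Or S0 : List ℕ) (g f a b c : ℕ) (h : Heap) : Set where
      constructor mkCircChildrenRun
      field
        cost g′ f′ a′ b′ c′ : ℕ
        h′ : Heap
        cost-bound : cost ≤ 18 + 100 * qLenL ts
        out-bound : length (encCL (resolveL (just dc) (expandL ts))) ≤ qLenL ts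
        invariant : HeapInv h′ (encCL (resolveL (just dc) (expandL ts)) ʳ++ Or) S0
        steps : Steps transducer cost (cfg pc-return p Or (length ts ∷ (3 + fc) ∷ S0) g f a b c h)
                          (cfg pc-return (qLenL ts + p) (encCL (resolveL (just dc) (expandL ts)) ʳ++ Or) S0 g′ f′ a′ b′ c′ h′)

    circChildren : ∀ dc ts → All TreeSpec ts → ∀ fc → minusFlag (just dc) ≡ fc → ∀ p Or S0 g f a b c h →
              HeapInv h Or (length ts ∷ (3 + fc) ∷ S0) → InputAt p (encQL ts) → CircChildrenRun dc ts fc p Or S0 g f a b c h
    circChildren dc [] [] fc refl p Or S0 g f a b c h hi at =
      mkCircChildrenRun 18 _ _ _ _ _ h ≤-refl z≤n (pop {S = S0} (3 + fc) (pop {S = (3 + fc) ∷ S0} 0 hi)) (returnCircDone p Or fc S0 g f a b c h hi)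
    circChildren dc (t ∷ ts) (q ∷ qs) fc refl p Or S0 g f a b c h hi at =
      mkCircChildrenRun (21 + (TreeRun.cost Q + CircChildrenRun.cost rest)) _ _ _ _ _ (CircChildrenRun.h′ rest)
        (subst (λ z → 21 + (TreeRun.cost Q + CircChildrenRun.cost rest) ≤ 18 + 100 * z) (sym (length-++ (encQ t)))
           (cost-circChild (TreeRun.cost Q) (CircChildrenRun.cost rest) (qLen t) (qLenL ts) (TreeRun.cost-bound Q) (CircChildrenRun.cost-bound rest)))
        (subst (_≤ qLenL (t ∷ ts)) (sym (length-++ (out (just dc) t)))
           (subst (λ z → length (out (just dc) t) + length (encCL (resolveL (just dc) (expandL ts))) ≤ z) (sym (length-++ (encQ t)))
             (+-mono-≤ (TreeRun.out-bound Q) (CircChildrenRun.out-bound rest))))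
        (subst (λ O → HeapInv (CircChildrenRun.h′ rest) O S0) out≡ (CircChildrenRun.invariant rest))
        (returnCircNext p Or (length ts) fc S0 g f a b c h hi ⟩ (TreeRun.steps Q ⟩ retarget {S = S0} inputPos≡ out≡ refl (CircChildrenRun.steps rest)))
      where
      fc′ = minusFlag (just dc)
      S1 = length ts ∷ (3 + fc′) ∷ S0
      h1 = stackWrite h ((3 + fc′) ∷ S0) (length ts)
      Q = q (just dc) p Or S1 g (8 + (suc (double (suc (length S0))) + E)) 1 0 h1 (replaceTop (suc (length ts)) (length ts) hi) (InputAt-++ˡ (encQ t) at)
      rest = circChildren dc ts qs fc′ refl (qLen t + p) (out (just dc) t ʳ++ Or) S0 (TreeRun.g′ Q) (TreeRun.f′ Q) (TreeRun.a′ Q) (TreeRun.b′ Q) (TreeRun.c′ Q) (TreeRun.h′ Q) (TreeRun.invariant Q) (InputAt-++ʳ (encQ t) at)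
      out≡ : encCL (resolveL (just dc) (expandL ts)) ʳ++ (out (just dc) t ʳ++ Or) ≡ encCL (resolveL (just dc) (expandL (t ∷ ts))) ʳ++ Or
      out≡ = sym (++-ʳ++ (out (just dc) t))
      inputPos≡ : qLenL ts + (qLen t + p) ≡ qLenL (t ∷ ts) + p
      inputPos≡ = trans (sym (+-assoc (qLenL ts) (qLen t) p)) (cong (_+ p) (trans (+-comm (qLenL ts) (qLen t)) (sym (length-++ (encQ t)))))

    record GadgetNodeRun (d : CDec) (gs : List (Tree CDec)) (ts : List (Tree QDec)) (p g0 : ℕ) (Or S : List ℕ) (f a b c : ℕ) (h : Heap) : Set where
      constructor mkGadgetNodeRun
      field
        cost f′ a′ b′ c′ : ℕ
        h′ : Heap
        cost-bound : cost + 30 ≤ 90 * cLen (node d gs) + 100 * qLenL ts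
        out-bound : length (outNode d gs ts) ≤ cLen (node d gs) + qLenL ts
        invariant : HeapInv h′ (outNode d gs ts ʳ++ Or) S
        steps : Steps transducer cost (cfg pc-node p Or S g0 f a b c h)
                          (cfg pc-return (qLenL ts + p) (outNode d gs ts ʳ++ Or) S (cLen (node d gs) + g0) f′ a′ b′ c′ h′)

    record GadgetChildrenRun (d : CDec) (gs : List (Tree CDec)) (ts : List (Tree QDec)) (p g0 : ℕ) (Or S0 : List ℕ) (f a b c : ℕ) (h : Heap) : Set where
      constructor mkGadgetChildrenRun
      field
        cost f′ a′ b′ c′ : ℕ
        h′ : Heap
        cost-bound : cost ≤ 15 + 90 * cLenL gs + 100 * qLenL ts
        out-bound : length (outChildren d gs ts) ≤ cLenL gs + qLenL ts
        invariant : HeapInv h′ (outChildren d gs ts ʳ++ Or) S0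
        steps : Steps transducer cost (cfg pc-return p Or (length gs ∷ 1 ∷ S0) g0 f a b c h)
                          (cfg pc-return (qLenL ts + p) (outChildren d gs ts ʳ++ Or) S0 (cLenL gs + g0) f′ a′ b′ c′ h′)

    length-resolved : ∀ d gs ts → length (resolveL (just d) (proj₁ (graftL gs (expandL ts)))) ≡ length gs
    length-resolved d gs ts = trans (length-resolveL (just d) (proj₁ (graftL gs (expandL ts)))) (length-graftL gs (expandL ts))

    mutual
      gadgetNode : ∀ d gs ts → MinusFree (node d gs) → leavesL gs ≡ length ts → All TreeSpec ts →
              ∀ p g0 Or S f a b c h → HeapInv h Or S → InputAt g0 (encC (node d gs)) → InputAt p (encQL ts) →
              GadgetNodeRun d gs ts p g0 Or S f a b c h
      gadgetNode d gs ts (nmd , nml) lv qs p g0 Or S f a b c h hi atG atC =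
        mkGadgetNodeRun (NodeHeader.cost H + (copyCost ws + (13 + GadgetChildrenRun.cost N))) (GadgetChildrenRun.f′ N) (GadgetChildrenRun.a′ N) (GadgetChildrenRun.b′ N) (GadgetChildrenRun.c′ N) (GadgetChildrenRun.h′ N)
          (subst (λ z → NodeHeader.cost H + (copyCost ws + (13 + GadgetChildrenRun.cost N)) + 30 ≤ 90 * suc z + 100 * qLenL ts) (sym (length-++ ws))
             (cost-gadgetNode (NodeHeader.cost H) (copyCost ws) (GadgetChildrenRun.cost N) (length ws) (cLenL gs) (qLenL ts) (NodeHeader.cost-bound H) (copyCost≡ ws) (GadgetChildrenRun.cost-bound N)))
          olenC
          (subst (λ O → HeapInv (GadgetChildrenRun.h′ N) O S) out≡ (GadgetChildrenRun.invariant N))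
          (NodeHeader.steps H ⟩ (CopyRun.steps Cp ⟩ (nodeArity (length gs) (encCL gs) p O2 S g2 f (CopyRun.b′ Cp) (CopyRun.c′ Cp) h2 (proj₁ (CopyRun.invariant Cp)) at2 ⟩
            retarget {S = S} refl out≡ gadgetPos≡ (GadgetChildrenRun.steps N))))
        where
        ws = encCDec d
        H = nodeHeader d (length gs ∷ encCL gs) p Or S g0 f a b c h hi atG
        at1 = InputAt-++ˡ ws (InputAt-tail atG)
        Cp = copyWords ws p (1 ∷ Or) S (suc g0) f (NodeHeader.b′ H) (NodeHeader.c′ H) (outWrite h Or 1) (emit 1 hi) at1
        O2 = ws ʳ++ (1 ∷ Or)
        g2 = advance ws (suc g0)
        h2 = CopyRun.h′ Cp
        at2 : InputAt g2 (length gs ∷ encCL gs)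
        at2 = InputAt-cong (sym (advance≡+ ws (suc g0))) (InputAt-++ʳ ws (InputAt-tail atG))
        h3 = stackWrite (stackWrite (outWrite h2 O2 (length gs)) S 1) (1 ∷ S) (length gs)
        hi3 : HeapInv h3 (length gs ∷ O2) (length gs ∷ 1 ∷ S)
        hi3 = push (length gs) (push 1 (emit (length gs) (CopyRun.invariant Cp)))
        N = gadgetChildren d nmd gs ts nml lv qs p (suc g2) (length gs ∷ O2) S f (length gs) (CopyRun.b′ Cp) 0 h3 hi3 (InputAt-tail at2) atC
        R = resolveL (just d) (proj₁ (graftL gs (expandL ts)))
        out≡ : outChildren d gs ts ʳ++ (length gs ∷ O2) ≡ outNode d gs ts ʳ++ Or
        out≡ = sym (trans (++-ʳ++ ws {ys = length R ∷ encCL R} {zs = 1 ∷ Or}) (cong (λ z → encCL R ʳ++ (z ∷ O2)) (length-resolved d gs ts)))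
        gadgetPos≡ : cLenL gs + suc g2 ≡ cLen (node d gs) + g0
        gadgetPos≡ = trans (cong (λ z → cLenL gs + suc z) (advance≡+ ws (suc g0)))
               (trans (e0 (cLenL gs) (length ws) g0) (cong (λ z → suc z + g0) (sym (length-++ ws))))
          where
          e0 : ∀ s l g → s + suc (l + suc g) ≡ suc (l + suc s) + g
          e0 = solve-∀
        olenC : length (outNode d gs ts) ≤ cLen (node d gs) + qLenL ts
        olenC = subst (λ z → suc z ≤ cLen (node d gs) + qLenL ts) (sym (length-++ ws))
                 (subst (λ z → suc (length ws + suc (length (encCL R))) ≤ suc z + qLenL ts) (sym (length-++ ws))
                   (ar (length ws) (length (encCL R)) (cLenL gs) (qLenL ts) (GadgetChildrenRun.out-bound N)))
          where
          ar : ∀ l x s t → x ≤ s + t → suc (l + suc x) ≤ suc (l + suc s) + t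
          ar l x s t le = ≤-trans (s≤s (+-monoʳ-≤ l (s≤s le))) (≤-reflexive (e l s t))
            where
            e : ∀ l s t → suc (l + suc (s + t)) ≡ suc (l + suc s) + t
            e = solve-∀

      gadgetChildren : ∀ d → NotMinus d → ∀ gs ts → MinusFreeL gs → leavesL gs ≡ length ts → All TreeSpec ts →
              ∀ p g0 Or S0 f a b c h → HeapInv h Or (length gs ∷ 1 ∷ S0) → InputAt g0 (encCL gs) → InputAt p (encQL ts) →
              GadgetChildrenRun d gs ts p g0 Or S0 f a b c h
      gadgetChildren d nmd [] [] nml refl [] p g0 Or S0 f a b c h hi atG atC =
        mkGadgetChildrenRun 15 _ _ _ _ h ≤-refl z≤n (pop {S = S0} 1 (pop {S = 1 ∷ S0} 0 hi)) (returnNodeDone p Or S0 g0 f a b c h hi)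
      gadgetChildren d nmd (leaf ∷ gs) (t ∷ ts) (_ , nml) lv (q ∷ qs) p g0 Or S0 f a b c h hi atG atC =
        mkGadgetChildrenRun (16 + (12 + (TreeRun.cost Q + (16 + GadgetChildrenRun.cost N)))) (GadgetChildrenRun.f′ N) (GadgetChildrenRun.a′ N) (GadgetChildrenRun.b′ N) (GadgetChildrenRun.c′ N) (GadgetChildrenRun.h′ N)
          (subst (λ z → 16 + (12 + (TreeRun.cost Q + (16 + GadgetChildrenRun.cost N))) ≤ 15 + 90 * suc (cLenL gs) + 100 * z) (sym (length-++ (encQ t)))
             (cost-leafChild (TreeRun.cost Q) (GadgetChildrenRun.cost N) (qLen t) (cLenL gs) (qLenL ts) (TreeRun.cost-bound Q) (GadgetChildrenRun.cost-bound N)))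
          (subst (_≤ suc (cLenL gs) + qLenL (t ∷ ts)) (sym (length-++ (out (just d) t)))
            (subst (λ z → length (out (just d) t) + length (outChildren d gs ts) ≤ suc (cLenL gs) + z) (sym (length-++ (encQ t)))
              (≤-trans (+-mono-≤ (TreeRun.out-bound Q) (GadgetChildrenRun.out-bound N)) (e1 (qLen t) (cLenL gs) (qLenL ts)))))
          (subst (λ O → HeapInv (GadgetChildrenRun.h′ N) O S0) out≡ (GadgetChildrenRun.invariant N))
          (returnNodeNext p Or (length gs) S0 g0 f a b c h hi ⟩
           (gadgetLeaf (encCL gs) p Or S1 g0 f V 1 0 h1 (proj₁ hi1) atG ⟩
            (subst (λ z → Steps transducer (TreeRun.cost Q) (cfg pc-visit p Or (W ∷ 2 ∷ S1) (suc g0) z 0 1 0 h2) (cfg pc-return (qLen t + p) O′ (W ∷ 2 ∷ S1) (TreeRun.g′ Q) (TreeRun.f′ Q) (TreeRun.a′ Q) (TreeRun.b′ Q) (TreeRun.c′ Q) (TreeRun.h′ Q)))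
                   (minusFlag-NotMinus d nmd) (TreeRun.steps Q) ⟩
             (returnGadgetLeaf (qLen t + p) O′ (suc g0) S1 (TreeRun.g′ Q) (TreeRun.f′ Q) (TreeRun.a′ Q) (TreeRun.b′ Q) (TreeRun.c′ Q) (TreeRun.h′ Q) (TreeRun.invariant Q) ⟩
              retarget {S = S0} inputPos≡ out≡ gadgetPos≡ (GadgetChildrenRun.steps N)))))
        where
        S1 = length gs ∷ 1 ∷ S0
        V = 8 + (suc (double (suc (length S0))) + E)
        h1 = stackWrite h (1 ∷ S0) (length gs)
        hi1 = replaceTop (suc (length gs)) (length gs) hi
        W = 8 + (suc g0 + D)
        h2 = stackWrite (stackWrite h1 S1 2) (2 ∷ S1) W
        hi2 : HeapInv h2 Or (W ∷ 2 ∷ S1)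
        hi2 = push W (push 2 hi1)
        Q = q (just d) p Or (W ∷ 2 ∷ S1) (suc g0) 0 1 0 h2 hi2 (InputAt-++ˡ (encQ t) atC)
        O′ = out (just d) t ʳ++ Or
        N = gadgetChildren d nmd gs ts nml (suc-injective lv) qs (qLen t + p) (suc g0) O′ S0 (TreeRun.f′ Q) (8 + (suc (double (suc (length S1))) + E)) 0 0 (TreeRun.h′ Q)
              (pop {S = S1} 2 (pop {S = 2 ∷ S1} W (TreeRun.invariant Q))) (InputAt-tail atG) (InputAt-++ʳ (encQ t) atC)
        inputPos≡ : qLenL ts + (qLen t + p) ≡ qLenL (t ∷ ts) + p
        inputPos≡ = trans (sym (+-assoc (qLenL ts) (qLen t) p)) (cong (_+ p) (trans (+-comm (qLenL ts) (qLen t)) (sym (length-++ (encQ t)))))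
        out≡ : outChildren d gs ts ʳ++ O′ ≡ outChildren d (leaf ∷ gs) (t ∷ ts) ʳ++ Or
        out≡ = sym (++-ʳ++ (out (just d) t))
        gadgetPos≡ : cLenL gs + suc g0 ≡ cLenL (leaf ∷ gs) + g0
        gadgetPos≡ = +-suc (cLenL gs) g0
        e1 : ∀ a s b → a + (s + b) ≤ suc s + (a + b)
        e1 a s b = ≤-trans (≤-reflexive (e a s b)) (n≤1+n _)
          where
          e : ∀ a s b → a + (s + b) ≡ s + (a + b)
          e = solve-∀
      gadgetChildren d nmd (node d′ cs ∷ gs) ts ((nmd′ , nmcs) , nml) lv qs p g0 Or S0 f a b c h hi atG atC
        with splitAtLength (leavesL cs) ts (subst (leavesL cs ≤_) lv (m≤m+n (leavesL cs) (leavesL gs)))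
      ... | ts1 , ts2 , refl , e2 =
        mkGadgetChildrenRun (16 + (GadgetNodeRun.cost C + GadgetChildrenRun.cost N)) (GadgetChildrenRun.f′ N) (GadgetChildrenRun.a′ N) (GadgetChildrenRun.b′ N) (GadgetChildrenRun.c′ N) (GadgetChildrenRun.h′ N)
          (subst₂ (λ y z → 16 + (GadgetNodeRun.cost C + GadgetChildrenRun.cost N) ≤ 15 + 90 * y + 100 * z) (sym (length-++ (encC g))) (sym eL)
             (cost-nodeChild (GadgetNodeRun.cost C) (GadgetChildrenRun.cost N) (cLen g) (qLenL ts1) (cLenL gs) (qLenL ts2) (GadgetNodeRun.cost-bound C) (GadgetChildrenRun.cost-bound N)))
          (subst (_≤ cLenL (g ∷ gs) + qLenL (ts1 ++ ts2)) (sym (cong length (outChildren-node d d′ cs gs ts1 ts2 e2)))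
            (subst (_≤ cLenL (g ∷ gs) + qLenL (ts1 ++ ts2)) (sym (length-++ (outNode d′ cs ts1)))
              (subst₂ (λ y z → length (outNode d′ cs ts1) + length (outChildren d gs ts2) ≤ y + z) (sym (length-++ (encC g))) (sym eL)
                (≤-trans (+-mono-≤ (GadgetNodeRun.out-bound C) (GadgetChildrenRun.out-bound N)) (≤-reflexive (+-interchange (cLen g) (qLenL ts1) (cLenL gs) (qLenL ts2)))))))
          (subst (λ O → HeapInv (GadgetChildrenRun.h′ N) O S0) out≡ (GadgetChildrenRun.invariant N))
          (returnNodeNext p Or (length gs) S0 g0 f a b c h hi ⟩
           (GadgetNodeRun.steps C ⟩ retarget {S = S0} inputPos≡ out≡ gadgetPos≡ (GadgetChildrenRun.steps N)))
        where
        g = node d′ cs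
        S1 = length gs ∷ 1 ∷ S0
        V = 8 + (suc (double (suc (length S0))) + E)
        h1 = stackWrite h (1 ∷ S0) (length gs)
        hi1 = replaceTop (suc (length gs)) (length gs) hi
        atC′ : InputAt p (encQL ts1 ++ encQL ts2)
        atC′ = subst (InputAt p) (encTreeL-++ encQDec ts1 ts2) atC
        eL : qLenL (ts1 ++ ts2) ≡ qLenL ts1 + qLenL ts2
        eL = trans (cong length (encTreeL-++ encQDec ts1 ts2)) (length-++ (encQL ts1))
        lv2 : leavesL gs ≡ length ts2
        lv2 = +-cancelˡ-≡ (leavesL cs) _ _ (trans lv (trans (length-++ ts1) (cong (_+ length ts2) e2)))
        C = gadgetNode d′ cs ts1 (nmd′ , nmcs) (sym e2) (AllP.++⁻ˡ ts1 qs) p g0 Or S1 f V 1 0 h1 hi1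
              (InputAt-++ˡ (encC g) atG) (InputAt-++ˡ (encQL ts1) atC′)
        N = gadgetChildren d nmd gs ts2 nml lv2 (AllP.++⁻ʳ ts1 qs) (qLenL ts1 + p) (cLen g + g0) (outNode d′ cs ts1 ʳ++ Or) S0
              (GadgetNodeRun.f′ C) (GadgetNodeRun.a′ C) (GadgetNodeRun.b′ C) (GadgetNodeRun.c′ C) (GadgetNodeRun.h′ C) (GadgetNodeRun.invariant C)
              (InputAt-++ʳ (encC g) atG) (InputAt-++ʳ (encQL ts1) atC′)
        inputPos≡ : qLenL ts2 + (qLenL ts1 + p) ≡ qLenL (ts1 ++ ts2) + p
        inputPos≡ = trans (sym (+-assoc (qLenL ts2) (qLenL ts1) p)) (cong (_+ p) (trans (+-comm (qLenL ts2) (qLenL ts1)) (sym eL)))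
        out≡ : outChildren d gs ts2 ʳ++ (outNode d′ cs ts1 ʳ++ Or) ≡ outChildren d (g ∷ gs) (ts1 ++ ts2) ʳ++ Or
        out≡ = trans (sym (++-ʳ++ (outNode d′ cs ts1))) (cong (_ʳ++ Or) (sym (outChildren-node d d′ cs gs ts1 ts2 e2)))
        gadgetPos≡ : cLenL gs + (cLen g + g0) ≡ cLenL (g ∷ gs) + g0
        gadgetPos≡ = trans (trans (sym (+-assoc (cLenL gs) (cLen g) g0)) (cong (_+ g0) (+-comm (cLenL gs) (cLen g)))) (cong (_+ g0) (sym (length-++ (encC g))))
        +-interchange : ∀ a b c d → (a + b) + (c + d) ≡ (a + c) + (b + d)
        +-interchange = solve-∀

    mutual
      treeSpec : ∀ t → Shaped t → TreeSpec t
      treeSpec leaf _ pp p Or S g a b c h hi at =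
        mkTreeRun 10 g (minusFlag pp) 0 b 0 (outWrite h Or 0) (≤ᵇ⇒≤ 40 100 tt) ≤-refl (emit 0 hi) (visitLeaf p Or S g (minusFlag pp) a b c h (proj₁ hi) at)
      treeSpec (node (circ k0) ts) gl pp p Or S g a b c h hi at =
        mkTreeRun (40 + CircChildrenRun.cost rest) _ _ _ _ _ (CircChildrenRun.h′ rest) (cost-circ (CircChildrenRun.cost rest) (qLenL ts) (CircChildrenRun.cost-bound rest)) olenQ
           (subst (λ O → HeapInv (CircChildrenRun.h′ rest) O S) out≡ (CircChildrenRun.invariant rest))
           (visitCirc k0 (length ts) (encQL ts) p Or S g f a b c h hi at ⟩ retarget {S = S} inputPos≡ out≡ refl (CircChildrenRun.steps rest))
        where
        f = minusFlag pp
        dc = resolveDec pp (circI k0)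
        fc = 1 ∸ f
        O1 = length ts ∷ k0 ∷ (2 ∸ f) ∷ 1 ∷ Or
        h6 = stackWrite (stackWrite (outWrite (outWrite (outWrite (outWrite h Or 1) (1 ∷ Or) (2 ∸ f)) ((2 ∸ f) ∷ 1 ∷ Or) k0) (k0 ∷ (2 ∸ f) ∷ 1 ∷ Or) (length ts)) S (3 + fc)) ((3 + fc) ∷ S) (length ts)
        hi6 : HeapInv h6 O1 (length ts ∷ (3 + fc) ∷ S)
        hi6 = push (length ts) (push (3 + fc) (emit (length ts) (emit k0 (emit (2 ∸ f) (emit 1 hi)))))
        rest = circChildren dc ts (treeSpecL ts gl) fc (minusFlag-resolveCirc pp k0) (4 + p) O1 S g f (length ts) (3 + fc) 0 h6 hi6
               (InputAt-tail (InputAt-tail (InputAt-tail (InputAt-tail at))))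
        out≡ : encCL (resolveL (just dc) (expandL ts)) ʳ++ O1 ≡ out pp (node (circ k0) ts) ʳ++ Or
        out≡ = cong (_ʳ++ Or) (sym (out-circ pp k0 ts))
        inputPos≡ : qLenL ts + (4 + p) ≡ qLen (node (circ k0) ts) + p
        inputPos≡ = e0 (qLenL ts) p
          where
          e0 : ∀ s p → s + (4 + p) ≡ 4 + s + p
          e0 = solve-∀
        olenQ : length (out pp (node (circ k0) ts)) ≤ qLen (node (circ k0) ts)
        olenQ = subst (λ z → length z ≤ 4 + qLenL ts) (sym (out-circ pp k0 ts)) (s≤s (s≤s (s≤s (s≤s (CircChildrenRun.out-bound rest)))))
      treeSpec (node (gad leaf) ts) () pp p Or S g a b c h hi at
      treeSpec (node (gad (node d gs)) ts) (nm , lv , gl) pp p Or S g a b c h hi at =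
        mkTreeRun (11 + (SkipTree.cost Sk + (3 + GadgetNodeRun.cost Cn))) (cLen G + (2 + p)) (GadgetNodeRun.f′ Cn) (GadgetNodeRun.a′ Cn) (GadgetNodeRun.b′ Cn) (GadgetNodeRun.c′ Cn) (GadgetNodeRun.h′ Cn)
           (subst (λ z → (11 + (SkipTree.cost Sk + (3 + GadgetNodeRun.cost Cn))) + 30 ≤ 100 * suc (suc z)) (sym (length-++ (encC G)))
             (cost-gadget (SkipTree.cost Sk) (GadgetNodeRun.cost Cn) (cLen G) (qLenL ts) (SkipTree.cost-bound Sk) (GadgetNodeRun.cost-bound Cn)))
           (≤-trans (GadgetNodeRun.out-bound Cn) (subst (λ z → cLen G + qLenL ts ≤ suc (suc z)) (sym (length-++ (encC G)))
              (≤-trans (+-monoʳ-≤ (cLen G) (n≤1+n (qLenL ts))) (≤-trans (n≤1+n _) (n≤1+n _)))))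
           (GadgetNodeRun.invariant Cn)
           (visitGadget rest p Or S g (minusFlag pp) a b c h (proj₁ hi) at ⟩
            (SkipTree.steps Sk ⟩ (skipEnd X p Or S (2 + p) (SkipTree.b′ Sk) (SkipTree.k′ Sk) h ⟩ retarget {O1 = outNode d gs ts ʳ++ Or} {S = S} {g1 = cLen G + (2 + p)} inputPos≡ refl refl (GadgetNodeRun.steps Cn))))
        where
        G = node d gs
        rest = encC G ++ (length ts ∷ encQL ts)
        at2 : InputAt (2 + p) rest
        at2 = InputAt-tail (InputAt-tail at)
        atG = InputAt-++ˡ (encC G) at2
        X = cLen G + (2 + p)
        atC : InputAt (suc X) (encQL ts)
        atC = InputAt-tail (InputAt-++ʳ (encC G) at2)
        Sk = skipTree G (2 + p) p Or S (2 + p) 0 0 0 h (proj₁ hi) atG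
        Cn = gadgetNode d gs ts nm lv (treeSpecL ts gl) (suc X) (2 + p) Or S 0 (8 + (X + D)) (SkipTree.b′ Sk) 1 h hi atG atC
        inputPos≡ : qLenL ts + suc X ≡ qLen (node (gad G) ts) + p
        inputPos≡ = trans (e0 (qLenL ts) (cLen G) p) (cong (λ z → suc (suc z) + p) (sym (length-++ (encC G))))
          where
          e0 : ∀ s g p → s + suc (g + (2 + p)) ≡ suc (suc (g + suc s)) + p
          e0 = solve-∀

      treeSpecL : ∀ ts → ShapedL ts → All TreeSpec ts
      treeSpecL [] _ = []
      treeSpecL (t ∷ ts) (gt , gts) = treeSpec t gt ∷ treeSpecL ts gts


module WholeRun where
  open RAM
  open Transducer
  open Output
  open Layout
  open Skip
  open Correct

  -- The initial memory is viewed as four registers holding n, 1, x1, x2 followed by the heap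
  -- `lookupD ys`; the prologue first copies the whole input above the cells it will use.
  module OnInput (x1 x2 : ℕ) (ys : List ℕ) where
    xs : List ℕ
    xs = 1 ∷ x1 ∷ x2 ∷ ys
    n : ℕ
    n = length xs

    SourceIntact : Heap → Set
    SourceIntact h = ∀ y → y < length ys → h y ≡ lookupD ys y

    Shifted : Heap → ℕ → Set
    Shifted h i = ∀ j → j < 3 + i → h (j + (5 + n)) ≡ lookupD xs j

    record ShiftRun (i : ℕ) (v w : ℕ) (h : Heap) : Set where
      constructor mkShiftRun
      field
        cost v′ : ℕ
        h′ : Heap
        cost≡ : cost ≡ 13 * (length ys ∸ i) + 4
        dst : Shifted h′ (length ys)
        steps : Steps transducer cost (pc-shift , n ∷ (4 + i) ∷ v ∷ w ∷ [] , h) (pc-shifted , n ∷ (4 + length ys) ∷ v′ ∷ 0 ∷ [] , h′)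

    shiftLoop : ∀ r i v w h → i + r ≡ length ys → SourceIntact h → Shifted h i → ShiftRun i v w h
    shiftLoop zero i v w h e src dst rewrite +-identityʳ i | e =
      mkShiftRun 4 v h (cong (λ z → 13 * z + 4) (sym (n∸n≡0 (length ys)))) dst
        (compute 3 _ (15 , n ∷ (4 + length ys) ∷ v ∷ (length ys ∸ length ys) ∷ [] , h) refl ⟩
         rewriteReg 3 0 (n∸n≡0 (length ys)) ⟩ compute 1 _ _ refl)
    shiftLoop (suc r) i v w h e src dst =
      mkShiftRun (3 + (0 + (10 + ShiftRun.cost L))) (ShiftRun.v′ L) (ShiftRun.h′ L)
         (trans (cong (13 +_) (ShiftRun.cost≡ L)) (trans (e13 (length ys ∸ suc i)) (cong (λ z → 13 * z + 4) (sym dd))))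
         (ShiftRun.dst L)
         (compute 3 _ (15 , n ∷ (4 + i) ∷ v ∷ (length ys ∸ i) ∷ [] , h) refl ⟩
          rewriteReg 3 (suc r) ei ⟩
          compute 10 _ (pc-shift , n ∷ (4 + suc i) ∷ h i ∷ 0 ∷ [] , h1) refl ⟩ ShiftRun.steps L)
      where
      ilt : i < length ys
      ilt = subst (i <_) e (≤-trans (s≤s (m≤m+n i r)) (≤-reflexive (sym (+-suc i r))))
      ei : length ys ∸ i ≡ suc r
      ei = trans (cong (_∸ i) (sym e)) (m+n∸m≡n i (suc r))
      dd : length ys ∸ i ≡ suc (length ys ∸ suc i)
      dd = trans ei (cong suc (sym (trans (cong (_∸ suc i) (sym e)) (trans (cong (_∸ suc i) (+-suc i r)) (m+n∸m≡n i r)))))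
      e13 : ∀ k → 13 + (13 * k + 4) ≡ 13 * suc k + 4
      e13 = solve-∀
      h1 = heapWrite h (i + (8 + n)) (h i)
      big : ∀ y → y < length ys → ¬ y ≡ i + (8 + n)
      big y lt eq = <⇒≢ (≤-trans lt (≤-trans (n≤1+n _) (≤-trans (n≤1+n _) (≤-trans (n≤1+n _) (≤-trans (m≤n+m n 8) (m≤n+m (8 + n) i)))))) eq
      src1 : SourceIntact h1
      src1 y lt = trans (heapWrite-miss h _ (h i) y (big y lt)) (src y lt)
      dst1 : Shifted h1 (suc i)
      dst1 j lt with m≤n⇒m<n∨m≡n (≤-pred lt)
      ... | inj₂ refl = trans (wrH-hit′) (src i ilt)
        where
        wrH-hit′ : h1 ((3 + i) + (5 + n)) ≡ h i
        wrH-hit′ = trans (cong h1 (ar i n)) (heapWrite-hit h _ (h i))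
          where
          ar : ∀ i n → (3 + i) + (5 + n) ≡ i + (8 + n)
          ar = solve-∀
      ... | inj₁ lt2 = trans (heapWrite-miss h _ (h i) _ (λ eq → <⇒≢ (+-monoˡ-< (5 + n) lt2) (trans eq (ar i n)))) (dst j lt2)
        where
        ar : ∀ i n → i + (8 + n) ≡ (3 + i) + (5 + n)
        ar = solve-∀
      L = shiftLoop r (suc i) (h i) 0 h1 (trans (sym (+-suc i r)) e) src1 dst1

    heapAfterSetup : Heap
    heapAfterSetup = heapWrite (heapWrite (heapWrite (lookupD ys) (7 + n) x2) (6 + n) x1) (5 + n) 1

    setup : Steps transducer 12 (0 , n ∷ 1 ∷ x1 ∷ x2 ∷ [] , lookupD ys) (pc-shift , n ∷ 4 ∷ 1 ∷ (9 + n) ∷ [] , heapAfterSetup)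
    setup = compute 12 _ _ refl

    source≢shifted : ∀ y k → y < length ys → ¬ y ≡ k + n
    source≢shifted y k lt eq = <⇒≢ (≤-trans lt (≤-trans (n≤1+n _) (≤-trans (n≤1+n _) (≤-trans (n≤1+n _) (m≤n+m n k))))) eq

    source-setup : SourceIntact heapAfterSetup
    source-setup y lt = trans (heapWrite-miss _ _ 1 y (source≢shifted y 5 lt))
                  (trans (heapWrite-miss _ _ x1 y (source≢shifted y 6 lt)) (heapWrite-miss _ _ x2 y (source≢shifted y 7 lt)))

    shifted-setup : Shifted heapAfterSetup 0
    shifted-setup zero lt = heapWrite-hit _ _ 1
    shifted-setup (suc zero) lt = trans (heapWrite-miss _ _ 1 _ (λ e → <⇒≢ (≤-refl) (sym e))) (heapWrite-hit _ _ x1)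
    shifted-setup (suc (suc zero)) lt =
      trans (heapWrite-miss _ _ 1 _ (λ e → <⇒≢ (n≤1+n _) (sym e)))
        (trans (heapWrite-miss _ _ x1 _ (λ e → <⇒≢ ≤-refl (sym e))) (heapWrite-hit _ _ x2))
    shifted-setup (suc (suc (suc j))) (s≤s (s≤s (s≤s ())))

    initMem≗ : initMem xs ≗ withRegs (n ∷ 1 ∷ x1 ∷ x2 ∷ []) (lookupD ys)
    initMem≗ zero = refl
    initMem≗ (suc zero) = refl
    initMem≗ (suc (suc zero)) = refl
    initMem≗ (suc (suc (suc zero))) = refl
    initMem≗ (suc (suc (suc (suc y)))) = refl

    regs4≗regs8 : ∀ (a b c d : ℕ) (h : Heap) → withRegs (a ∷ b ∷ c ∷ d ∷ []) h ≗ withRegs (a ∷ b ∷ c ∷ d ∷ h 0 ∷ h 1 ∷ h 2 ∷ h 3 ∷ []) (λ y → h (4 + y))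
    regs4≗regs8 a b c d h zero = refl
    regs4≗regs8 a b c d h (suc zero) = refl
    regs4≗regs8 a b c d h (suc (suc zero)) = refl
    regs4≗regs8 a b c d h (suc (suc (suc zero))) = refl
    regs4≗regs8 a b c d h (suc (suc (suc (suc zero)))) = refl
    regs4≗regs8 a b c d h (suc (suc (suc (suc (suc zero))))) = refl
    regs4≗regs8 a b c d h (suc (suc (suc (suc (suc (suc zero)))))) = refl
    regs4≗regs8 a b c d h (suc (suc (suc (suc (suc (suc (suc zero))))))) = refl
    regs4≗regs8 a b c d h (suc (suc (suc (suc (suc (suc (suc (suc y)))))))) = refl

    open Machine xs n
    open Skipping xs n
    open Correctness xs n

    shifted⇒InputIntact : ∀ h → Shifted h (length ys) → InputIntact (λ y → h (4 + y))
    shifted⇒InputIntact h dst j lt = trans (cong h (ar j n)) (dst j lt)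
      where
      ar : ∀ j n → 4 + (j + suc n) ≡ j + (5 + n)
      ar = solve-∀

    initStack : ∀ s v w q0 q1 q2 q3 (h : Heap) →
      Steps transducer 16 (pc-shifted , n ∷ s ∷ v ∷ w ∷ q0 ∷ q1 ∷ q2 ∷ q3 ∷ [] , h)
                 (cfg pc-visit 0 [] (0 ∷ 0 ∷ []) 0 0 (n + suc n) 2 8 (stackWrite (stackWrite h [] 0) (0 ∷ []) 0))
    initStack s v w q0 q1 q2 q3 h = compute 16 _ _ refl

    record PrologueRun : Set where
      constructor mkPrologueRun
      field
        cost : ℕ
        h8 : Heap
        cost≡ : cost ≡ 12 + (13 * (length ys ∸ 0) + 4) + 16
        inp : InputIntact h8
        steps : Steps transducer cost (0 , n ∷ 1 ∷ x1 ∷ x2 ∷ [] , lookupD ys) (cfg pc-visit 0 [] (0 ∷ 0 ∷ []) 0 0 (n + suc n) 2 8 (stackWrite (stackWrite h8 [] 0) (0 ∷ []) 0))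

    prologue : PrologueRun
    prologue =
      mkPrologueRun _ h8 (cong (λ z → 12 + (z + (0 + 16))) (ShiftRun.cost≡ L) ∙ e0 (13 * (length ys ∸ 0) + 4)) (shifted⇒InputIntact (ShiftRun.h′ L) (ShiftRun.dst L))
        (setup ⟩ (ShiftRun.steps L ⟩ (reframe (pc-shifted , n ∷ (4 + length ys) ∷ ShiftRun.v′ L ∷ 0 ∷ [] , ShiftRun.h′ L) (pc-shifted , n ∷ (4 + length ys) ∷ ShiftRun.v′ L ∷ 0 ∷ ShiftRun.h′ L 0 ∷ ShiftRun.h′ L 1 ∷ ShiftRun.h′ L 2 ∷ ShiftRun.h′ L 3 ∷ [] , h8) refl (regs4≗regs8 n (4 + length ys) (ShiftRun.v′ L) 0 (ShiftRun.h′ L)) ⟩ initStack _ _ _ _ _ _ _ h8)))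
      where
      L = shiftLoop (length ys) 0 1 (9 + n) heapAfterSetup refl source-setup shifted-setup
      h8 = λ y → ShiftRun.h′ L (4 + y)
      _∙_ = trans
      e0 : ∀ a → 12 + (a + (0 + 16)) ≡ 12 + a + 16
      e0 = solve-∀

    double-∸ : ∀ a b x → (double a + x) ∸ (double b + x) ≡ double (a ∸ b)
    double-∸ zero zero x = n∸n≡0 x
    double-∸ zero (suc b) x = m≤n⇒m∸n≡0 (≤-trans (m≤n+m x (double b)) (≤-trans (n≤1+n _) (n≤1+n _)))
    double-∸ (suc a) zero x = m+n∸n≡m (double (suc a)) x
    double-∸ (suc a) (suc b) x = double-∸ a b x

    countOutput : ∀ Or S g f r c → r + c ≡ length Or → ∀ k h →
          Steps transducer (8 * r + 2) (cfg pc-count n Or S g f c (8 + (double c + E)) k h)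
                              (cfg pc-counted n Or S g f (length Or) (8 + (double (length Or) + E)) 0 h)
    countOutput Or S g f zero c refl k h =
      compute 1 _ (cfg 218 n Or S g f c (8 + (double c + E)) ((8 + (double c + E)) ∸ (8 + (double c + E))) h) refl ⟩
      rewriteReg 7 0 (trans (double-∸ c c E) (cong double (n∸n≡0 c))) ⟩ compute 1 _ _ refl
    countOutput Or S g f (suc r) c e k h =
      Steps-cost (e0 r)
       (compute 1 _ (cfg 218 n Or S g f c (8 + (double c + E)) ((8 + (double (length Or) + E)) ∸ (8 + (double c + E))) h) refl ⟩
        rewriteReg 7 (double (suc r)) (trans (double-∸ (length Or) c E) (cong double (trans (cong (_∸ c) (sym e)) (m+n∸n≡m (suc r) c)))) ⟩
        compute 7 _ (cfg pc-count n Or S g f (suc c) (8 + (double (suc c) + E)) 0 h) refl ⟩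
        countOutput Or S g f r (suc c) (trans (+-suc r c) e) 0 h)
      where
      e0 : ∀ r → 1 + (0 + (7 + (8 * r + 2))) ≡ 8 * suc r + 2
      e0 = solve-∀

    prepareCompaction : ∀ Or S g f h →
      Steps transducer 8 (cfg pc-counted n Or S g f (length Or) (8 + (double (length Or) + E)) 0 h)
                (regState 233 (length Or) (8 + (double (length Or) + E)) (8 + (double 1 + E)) (8 + (double 6 + E))
                     (8 + (double (length Or) + E)) 7 (8 + (double (length Or) + E)) 0 h)
    prepareCompaction Or S g f h = compute 8 _ _ refl

    regs8≗regs7 : ∀ (a b c d e f g k : ℕ) (h : Heap) → withRegs (a ∷ b ∷ c ∷ d ∷ e ∷ f ∷ g ∷ k ∷ []) h ≗ withRegs (a ∷ b ∷ c ∷ d ∷ e ∷ f ∷ g ∷ []) (withRegs (k ∷ []) h)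
    regs8≗regs7 a b c d e f g k h zero = refl
    regs8≗regs7 a b c d e f g k h (suc zero) = refl
    regs8≗regs7 a b c d e f g k h (suc (suc zero)) = refl
    regs8≗regs7 a b c d e f g k h (suc (suc (suc zero))) = refl
    regs8≗regs7 a b c d e f g k h (suc (suc (suc (suc zero)))) = refl
    regs8≗regs7 a b c d e f g k h (suc (suc (suc (suc (suc zero))))) = refl
    regs8≗regs7 a b c d e f g k h (suc (suc (suc (suc (suc (suc zero)))))) = refl
    regs8≗regs7 a b c d e f g k h (suc (suc (suc (suc (suc (suc (suc y))))))) = refl

    -- Output word i goes to memory cell 1 + i.  The cells 1–6 are registers of the loop, so
    -- the first six words are loaded into them only after the loop.
    module Compaction (O : List ℕ) (Ln : length O ≤ n) where
      L = length O
      B2 = 8 + (double 1 + E)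
      EndV = 8 + (double L + E)
      SRC : ℕ → ℕ
      SRC c = 8 + (double (6 + c) + E)

      OutputReadable : Heap → Set
      OutputReadable h = ∀ i → i < L → h (suc (double i + E)) ≡ lookupD O i
      Compacted : Heap → ℕ → Set
      Compacted h c = ∀ i → i < c → h i ≡ lookupD O (6 + i)

      record CompactRun (r c t v : ℕ) (h : Heap) : Set where
        constructor mkCompactRun
        field
          sf pf vf : ℕ
          hf : Heap
          rinv : OutputReadable hf
          winv : Compacted hf (L ∸ 6)
          steps : Steps transducer (10 * r + 2) (pc-compact , L ∷ t ∷ B2 ∷ SRC c ∷ EndV ∷ (7 + c) ∷ v ∷ [] , h)
                                    (pc-compacted , L ∷ 0 ∷ B2 ∷ sf ∷ EndV ∷ pf ∷ vf ∷ [] , hf)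

      compactLoop : ∀ r c → r ≡ L ∸ (6 + c) → ∀ t v h → OutputReadable h → Compacted h c → CompactRun r c t v h
      compactLoop zero c e t v h ri wi =
        mkCompactRun (SRC c) (7 + c) v h ri (λ i lt → wi i (≤-trans lt le))
          (compute 1 _ (234 , L ∷ (EndV ∸ SRC c) ∷ B2 ∷ SRC c ∷ EndV ∷ (7 + c) ∷ v ∷ [] , h) refl ⟩
           rewriteReg 1 0 (trans (double-∸ L (6 + c) E) (cong double (sym e))) ⟩ compute 1 _ _ refl)
        where
        le : L ∸ 6 ≤ c
        le = m∸n≡0⇒m≤n (trans (∸-+-assoc L 6 c) (sym e))
      compactLoop (suc r) c e t v h ri wi =
        mkCompactRun (CompactRun.sf IH) (CompactRun.pf IH) (CompactRun.vf IH) (CompactRun.hf IH) (CompactRun.rinv IH) (CompactRun.winv IH)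
          (Steps-cost (e0 r)
            (compute 1 _ (234 , L ∷ (EndV ∸ SRC c) ∷ B2 ∷ SRC c ∷ EndV ∷ (7 + c) ∷ v ∷ [] , h) refl ⟩
             rewriteReg 1 (double (suc r)) (trans (double-∸ L (6 + c) E) (cong double (sym e))) ⟩
             compute 2 _ (236 , L ∷ double (suc r) ∷ B2 ∷ SRC c ∷ EndV ∷ (7 + c) ∷ h (suc (double (6 + c) + E)) ∷ [] , h) refl ⟩
             rewriteReg 6 (lookupD O (6 + c)) (ri (6 + c) lt6) ⟩
             compute 7 _ (pc-compact , L ∷ 0 ∷ B2 ∷ SRC (suc c) ∷ EndV ∷ (7 + suc c) ∷ lookupD O (6 + c) ∷ [] , h1) refl ⟩
             CompactRun.steps IH))
        where
        e0 : ∀ r → 1 + (0 + (2 + (0 + (7 + (10 * r + 2))))) ≡ 10 * suc r + 2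
        e0 = solve-∀
        lt6 : 6 + c < L
        lt6 = m∸n≢0⇒n<m (λ z → 1+n≢0 (trans e z))
        h1 = heapWrite h c (lookupD O (6 + c))
        cE : ∀ i → ¬ c ≡ suc (double i + E)
        cE i eq = <⇒≢ (s≤s (≤-trans (m≤n+m c 6) (≤-trans (<⇒≤ lt6) (≤-trans Ln (≤-trans (m≤m+n n D) (m≤n+m E (double i))))))) eq
        ri1 : OutputReadable h1
        ri1 i lt = trans (heapWrite-miss h c _ _ (λ eq → cE i (sym eq))) (ri i lt)
        wi1 : Compacted h1 (suc c)
        wi1 i (s≤s lt) with m≤n⇒m<n∨m≡n lt
        ... | inj₂ refl = heapWrite-hit h i _
        ... | inj₁ lt2 = trans (heapWrite-miss h c _ i (<⇒≢ lt2)) (wi i lt2)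
        IH = compactLoop r (suc c) (trans (cong pred e) (pred[m∸n]≡m∸[1+n] L (6 + c))) 0 (lookupD O (6 + c)) h1 ri1 wi1

      finalLoads : ∀ s p v (h : Heap) →
        Steps transducer 15 (pc-compacted , L ∷ 0 ∷ B2 ∷ s ∷ EndV ∷ p ∷ v ∷ [] , h)
                   (pc-halt , L ∷ h (suc (double 0 + E)) ∷ h (suc (double 1 + E)) ∷ h (suc (double 2 + E)) ∷ h (suc (double 3 + E))
                          ∷ h (suc (double 4 + E)) ∷ h (suc (double 5 + E)) ∷ [] , h)
      finalLoads s p v h = compute 15 _ _ refl

    input-at-0 : InputAt 0 xs
    input-at-0 k lt rewrite +-identityʳ k = lt , refl

    module Result (t : Tree QDec) (e : encQ t ≡ xs) (shaped : Shaped t) where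
      P = prologue
      h8 = PrologueRun.h8 P
      h0 = stackWrite (stackWrite h8 [] 0) (0 ∷ []) 0
      hi0 : HeapInv h0 [] (0 ∷ 0 ∷ [])
      hi0 = push 0 (push 0 (PrologueRun.inp P , tt , tt))
      Q = treeSpec t shaped nothing 0 [] (0 ∷ 0 ∷ []) 0 (n + suc n) 2 8 h0 hi0 (subst (InputAt 0) (sym e) input-at-0)
      O = out nothing t
      Or1 = O ʳ++ []
      L = length O
      sz : qLen t ≡ n
      sz = cong length e
      Ln : L ≤ n
      Ln = subst (L ≤_) sz (TreeRun.out-bound Q)
      eL : length Or1 ≡ L
      eL = trans (length-ʳ++ O) (+-identityʳ L)
      h′ = TreeRun.h′ Q
      g′ = TreeRun.g′ Q
      f′ = TreeRun.f′ Q

      s0 : State 0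
      s0 = 0 , [] , initMem xs

      mainPhase = reframe s0 (0 , n ∷ 1 ∷ x1 ∷ x2 ∷ [] , lookupD ys) refl initMem≗ ⟩
            (PrologueRun.steps P ⟩
            (TreeRun.steps Q ⟩
            (retarget {O1 = Or1} {S = 0 ∷ 0 ∷ []} {g1 = g′} (trans (+-identityʳ (qLen t)) sz) refl refl (returnBottom (qLen t + 0) Or1 g′ f′ (TreeRun.a′ Q) (TreeRun.b′ Q) (TreeRun.c′ Q) h′ (TreeRun.invariant Q)) ⟩
            (compute 3 _ (cfg pc-count n Or1 (0 ∷ 0 ∷ []) g′ f′ 0 (8 + (double 0 + E)) 0 h′) refl ⟩
            (countOutput Or1 (0 ∷ 0 ∷ []) g′ f′ (length Or1) 0 (+-identityʳ _) 0 h′ ⟩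
             subst (λ z → Steps transducer 8 (cfg pc-counted n Or1 (0 ∷ 0 ∷ []) g′ f′ (length Or1) (8 + (double (length Or1) + E)) 0 h′)
                                    (regState 233 z (8 + (double z + E)) (8 + (double 1 + E)) (8 + (double 6 + E)) (8 + (double z + E)) 7 (8 + (double z + E)) 0 h′))
                   eL (prepareCompaction Or1 (0 ∷ 0 ∷ []) g′ f′ h′))))))

      open Compaction O Ln hiding (L)

      h7 = withRegs (0 ∷ []) h′
      ri0 : OutputReadable h7
      ri0 i lt = OutputStored-lookup O [] (proj₁ (proj₂ (TreeRun.invariant Q))) i lt
      C = compactLoop (L ∸ 6) 0 refl (8 + (double L + E)) (8 + (double L + E)) h7 ri0 (λ i ())

      compactionPhase = reframe (pc-compact , L ∷ (8 + (double L + E)) ∷ (8 + (double 1 + E)) ∷ (8 + (double 6 + E)) ∷ (8 + (double L + E)) ∷ 7 ∷ (8 + (double L + E)) ∷ 0 ∷ [] , h′)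
                   (pc-compact , L ∷ (8 + (double L + E)) ∷ (8 + (double 1 + E)) ∷ (8 + (double 6 + E)) ∷ (8 + (double L + E)) ∷ 7 ∷ (8 + (double L + E)) ∷ [] , h7)
                   refl (regs8≗regs7 _ _ _ _ _ _ _ 0 h′) ⟩
            (CompactRun.steps C ⟩ finalLoads (CompactRun.sf C) (CompactRun.pf C) (CompactRun.vf C) (CompactRun.hf C))

      wholeRun = mainPhase ⟩ compactionPhase

      costOf : ∀ {k j P c} {s : State k} {s′ : State j} → Steps P c s s′ → ℕ
      costOf {c = c} _ = c

      K = costOf wholeRun

      lt6 : ∀ c → 6 + c < L → c < L ∸ 6
      lt6 c lt = m+n≤o⇒m≤o∸n (suc c) (subst (_≤ L) (cong suc (+-comm 6 c)) lt)

      hf = CompactRun.hf C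

      out-ok : Data.Maybe.map readOut (exec transducer (K + 1) 0 (initMem xs)) ≡ just O
      out-ok = readOut-result O (Steps-halt wholeRun refl) refl hyp
        where
        hyp : ∀ i → i < L → withRegs (L ∷ hf (suc (double 0 + E)) ∷ hf (suc (double 1 + E)) ∷ hf (suc (double 2 + E)) ∷ hf (suc (double 3 + E))
                          ∷ hf (suc (double 4 + E)) ∷ hf (suc (double 5 + E)) ∷ []) hf (suc i) ≡ lookupD O i
        hyp 0 lt = CompactRun.rinv C 0 lt
        hyp 1 lt = CompactRun.rinv C 1 lt
        hyp 2 lt = CompactRun.rinv C 2 lt
        hyp 3 lt = CompactRun.rinv C 3 lt
        hyp 4 lt = CompactRun.rinv C 4 lt
        hyp 5 lt = CompactRun.rinv C 5 lt
        hyp (suc (suc (suc (suc (suc (suc c)))))) lt = CompactRun.winv C c (lt6 c lt)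

      cost-total : ∀ kp kq lo L ly → kp ≡ 12 + (13 * (ly ∸ 0) + 4) + 16 → kq + 30 ≤ 100 * (3 + ly) → lo ≤ 3 + ly → L ≤ 3 + ly →
             (0 + (kp + (kq + (4 + (3 + ((8 * lo + 2) + 8)))))) + (0 + ((10 * (L ∸ 6) + 2) + 15)) + 1 ≤ 198 * (3 + ly)
      cost-total kp kq lo L ly refl hq hlo hL = begin
          (0 + ((12 + (13 * ly + 4) + 16) + (kq + (4 + (3 + ((8 * lo + 2) + 8)))))) + (0 + ((10 * (L ∸ 6) + 2) + 15)) + 1
            ≡⟨ e1 kq ly lo (L ∸ 6) ⟩
          (kq + 30) + (37 + 13 * ly + 8 * lo + 10 * (L ∸ 6))
            ≤⟨ +-mono-≤ hq (+-mono-≤ (+-monoʳ-≤ (37 + 13 * ly) (*-monoʳ-≤ 8 hlo)) (*-monoʳ-≤ 10 (≤-trans (m∸n≤m L 6) hL))) ⟩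
          100 * (3 + ly) + (37 + 13 * ly + 8 * (3 + ly) + 10 * (3 + ly))
            ≡⟨ e2 ly ⟩
          391 + 131 * ly
            ≤⟨ +-mono-≤ (≤ᵇ⇒≤ 391 594 tt) (*-monoˡ-≤ ly (≤ᵇ⇒≤ 131 198 tt)) ⟩
          594 + 198 * ly
            ≡⟨ e3 ly ⟩
          198 * (3 + ly) ∎
        where
        open ≤-Reasoning
        e1 : ∀ kq ly lo m → (0 + ((12 + (13 * ly + 4) + 16) + (kq + (4 + (3 + ((8 * lo + 2) + 8)))))) + (0 + ((10 * m + 2) + 15)) + 1 ≡ (kq + 30) + (37 + 13 * ly + 8 * lo + 10 * m)
        e1 = solve-∀
        e2 : ∀ ly → 100 * (3 + ly) + (37 + 13 * ly + 8 * (3 + ly) + 10 * (3 + ly)) ≡ 391 + 131 * ly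
        e2 = solve-∀
        e3 : ∀ ly → 594 + 198 * ly ≡ 198 * (3 + ly)
        e3 = solve-∀

      K-bound : K + 1 ≤ 198 * n
      K-bound = cost-total (PrologueRun.cost P) (TreeRun.cost Q) (length Or1) L (length ys) (PrologueRun.cost≡ P)
                (subst (λ z → TreeRun.cost Q + 30 ≤ 100 * z) sz (TreeRun.cost-bound Q)) (≤-trans (≤-reflexive eL) Ln) Ln

  transducer-correct : ∀ t → Shaped t →
    Σ ℕ λ k → (k ≤ 198 * qLen t) × (map readOut (exec transducer k 0 (initMem (encQ t))) ≡ just (encC (toCanonical t)))
  transducer-correct leaf _ = 2 , ≤ᵇ⇒≤ 2 198 tt , refl
  transducer-correct (node q ts) shaped with encQ-node q ts
  ... | x1 , x2 , ys , e =
    K + 1 , subst (λ m → K + 1 ≤ 198 * m) (sym (cong length e)) K-bound ,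
    subst (λ xs → map readOut (exec transducer (K + 1) 0 (initMem xs)) ≡ just (encC (toCanonical (node q ts)))) (sym e) out-ok
    where open OnInput.Result x1 x2 ys (node q ts) e shaped

open Transducer using (transducer)
open Output using (qLen; encQ; encC)
open Shape using (packed⇒shaped; encoding-linear)
open WholeRun using (transducer-correct)

lemma5p16 : (C : Perm → Set) → IsPermClass C → SubstClosed C →
  Σ Program λ P → Σ ℕ λ c →
    (t : Tree QDec) → Packed (SimplesOf C) t →
      Σ ℕ λ k → (k ≤ c * leaves t) ×
        (map readOut (exec P k 0 (initMem (encTree encQDec t)))
          ≡ just (encTree encCDec (toCanonical t)))
lemma5p16 C _ _ = transducer , 198 * 13 , linear-time
  where
  linear-time : (t : Tree QDec) → Packed (SimplesOf C) t →
    Σ ℕ λ k → (k ≤ 198 * 13 * leaves t) ×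
    (map readOut (exec transducer k 0 (initMem (encQ t))) ≡ just (encC (toCanonical t)))
  linear-time t packed with transducer-correct t (packed⇒shaped packed)
  ... | k , k≤ , correct = k , bound , correct
    where
    bound : k ≤ 198 * 13 * leaves t
    bound = begin
      k                        ≤⟨ k≤ ⟩
      198 * qLen t             ≤⟨ *-monoʳ-≤ 198 (encoding-linear packed) ⟩
      198 * (13 * leaves t)    ≡⟨ *-assoc 198 13 (leaves t) ⟨
      198 * 13 * leaves t      ∎
      where open ≤-Reasoning
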